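{- Let $C$ be a chord diagram with $n$ chords, and let $Q_C(u)=\det(uI-A_{\overrightarrow{g(C)}})$ for any choice of cut point. Then $Q_C(u)=Q_{g(C)}(u)$, where $g(C)$ is the (nonoriented) intersection graph of $C$. In particular, if two chord diagrams $C_1,C_2$ have isomorphic intersection graphs, then $Q_{C_1}=Q_{C_2}$.
   Context: A chord diagram of order $n$ is an oriented circle with $n$ disjoint pairs of distinct points (chords), up to orientation-preserving diffeomorphism. Its intersection graph $g(C)$ has the chords as vertices, two chords adjacent iff their endpoints alternate on the circle. A cut point is a point of the circle distinct from all chord endpoints; cutting there gives an oriented line, chords are numbered $1,\dots,n$ by the order of their first endpoints along the line, and each edge of $g(C)$ is oriented from the smaller to the larger number, giving $\overrightarrow{g(C)}$. Its antisymmetric adjacency matrix has $a_{ij}=1$ for an edge $i\to j$, $a_{ij}=-1$ for an edge $j\to i$, $0$ otherwise. (This determinant is independent of the cut point.) For a finite simple graph $G$: $A_G$ is the adjacency matrix over $\mathbb{F}_2$; $\nu(G)=1$ if $A_G$ is invertible over $\mathbb{F}_2$ and $0$ otherwise, with $\nu(\text{empty graph})=1$; $G(U)$ is the induced subgraph on $U$; and $Q_G(u)=\sum_{k\ge0}q_k(G)u^{|V(G)|-k}$ with $q_k(G)=\sum_{U\subseteq V(G),|U|=k}\nu(G(U))$. -}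

module Defs where

open import Level using (0ℓ)
open import Algebra.Bundles using (RawRing; CommutativeRing)
open import Data.Bool using (Bool; true; false; _∧_; _∨_; _xor_; if_then_else_; not)
open import Data.Nat as ℕ using (ℕ; zero; suc; _∸_; _<ᵇ_)
open import Data.Nat.Properties using ()
open import Data.Fin as Fin using (Fin; zero; suc; toℕ; punchIn)
open import Data.Fin.Subset using (Subset)
open import Data.Integer as ℤ using (ℤ)
import Data.Integer.Properties as ℤP
open import Data.Vec using (Vec; []; _∷_)
open import Data.List as List using (List; []; _∷_; length; lookup; filter)
open import Data.Product using (_×_)
open import Relation.Binary.PropositionalEquality using (_≡_; _≢_; refl)
open import Function.Bundles using (_↔_; Inverse)
open import Relation.Nullary.Decidable using (⌊_⌋)
open import Data.Bool.Properties using (∨-comm)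

module Det (R : RawRing 0ℓ 0ℓ) where
  open RawRing R

  sumFin : ∀ {n} → (Fin n → Carrier) → Carrier
  sumFin {zero}  f = 0#
  sumFin {suc n} f = f zero + sumFin (λ i → f (suc i))

  sgn : ∀ {n} → Fin n → Carrier
  sgn zero    = 1#
  sgn (suc j) = - sgn j

  det : ∀ n → (Fin n → Fin n → Carrier) → Carrier
  det zero    M = 1#
  det (suc n) M =
    sumFin (λ j → sgn j * (M zero j * det n (λ r c → M (suc r) (punchIn j c))))

ℤ-rawRing : RawRing 0ℓ 0ℓ
ℤ-rawRing = CommutativeRing.rawRing ℤP.+-*-commutativeRing

𝔽₂-rawRing : RawRing 0ℓ 0ℓ
𝔽₂-rawRing = record
  { Carrier = Bool ; _≈_ = _≡_ ; _+_ = _xor_ ; _*_ = _∧_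
  ; -_ = λ x → x ; 0# = false ; 1# = true }

detℤ : ∀ n → (Fin n → Fin n → ℤ) → ℤ
detℤ = Det.det ℤ-rawRing

det𝔽₂ : ∀ n → (Fin n → Fin n → Bool) → Bool
det𝔽₂ = Det.det 𝔽₂-rawRing

record SimpleGraph (n : ℕ) : Set where
  field
    adj     : Fin n → Fin n → Bool
    symm    : ∀ i j → adj i j ≡ adj j i
    irrefl  : ∀ i → adj i i ≡ false
open SimpleGraph public

elems : ∀ {n} → Subset n → List (Fin n)
elems []          = []
elems (true ∷ U)  = zero ∷ List.map suc (elems U)
elems (false ∷ U) = List.map suc (elems U)

subsets : ∀ n → List (Subset n)
subsets zero    = [] ∷ []
subsets (suc n) = List.map (true ∷_) (subsets n) List.++ List.map (false ∷_) (subsets n)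

inducedAdj : ∀ {n} → SimpleGraph n → (U : Subset n) →
             Fin (length (elems U)) → Fin (length (elems U)) → Bool
inducedAdj G U i j = adj G (lookup (elems U) i) (lookup (elems U) j)

-- ν(G(U)) : 1 if A_{G(U)} is invertible over 𝔽₂ (det = 1), else 0;
-- for U = ∅ the determinant of the empty matrix is 1, so ν = 1.
νInduced : ∀ {n} → SimpleGraph n → Subset n → ℕ
νInduced G U = if det𝔽₂ (length (elems U)) (inducedAdj G U) then 1 else 0

sumℕ : List ℕ → ℕ
sumℕ = List.foldr ℕ._+_ 0

sumℤ : List ℤ → ℤ
sumℤ = List.foldr ℤ._+_ ℤ.0ℤ

q : ∀ {n} → SimpleGraph n → ℕ → ℕ
q {n} G k = sumℕ (List.map (νInduced G)
              (filter (λ U → length (elems U) ℕ.≟ k) (subsets n)))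

-- Q_G(u) = Σ_{k=0}^{n} q_k(G) u^{n-k}, evaluated at u ∈ ℤ
-- (q_k = 0 for k > n, so the sum is finite)
QGraph : ∀ {n} → SimpleGraph n → ℤ → ℤ
QGraph {n} G u = sumℤ (List.map (λ k → ℤ.+ (q G k) ℤ.* (u ℤ.^ (n ∸ k)))
                   (List.upTo (suc n)))

-- Chord diagrams cut at a point: an oriented line (positions in ℕ) carrying
-- n chords; chord c has endpoints left c < right c, and all 2n endpoints are
-- pairwise distinct.

record LinChordDiagram (n : ℕ) : Set where
  field
    left right   : Fin n → ℕ
    left<right   : ∀ c → left c ℕ.< right c
    distinct     : ∀ c d → c ≢ d →
                   (left c ≢ left d) × (left c ≢ right d) × (right c ≢ right d)
open LinChordDiagram public

NumberedByFirstEndpoint : ∀ {n} → LinChordDiagram n → Set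
NumberedByFirstEndpoint D = ∀ i j → i Fin.< j → left D i ℕ.< left D j

crosses : ∀ {n} → LinChordDiagram n → Fin n → Fin n → Bool
crosses D c d =
  ((left D c <ᵇ left D d) ∧ (left D d <ᵇ right D c) ∧ (right D c <ᵇ right D d))
  ∨ ((left D d <ᵇ left D c) ∧ (left D c <ᵇ right D d) ∧ (right D d <ᵇ right D c))

intersectionGraph : ∀ {n} → LinChordDiagram n → SimpleGraph n
intersectionGraph D = record { adj = crosses D ; symm = sym' ; irrefl = irr }
  where
  <ᵇ-irrefl : ∀ m → (m <ᵇ m) ≡ false
  <ᵇ-irrefl zero    = refl
  <ᵇ-irrefl (suc m) = <ᵇ-irrefl m
  sym' : ∀ c d → crosses D c d ≡ crosses D d c
  sym' c d = ∨-comm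
    ((left D c <ᵇ left D d) ∧ (left D d <ᵇ right D c) ∧ (right D c <ᵇ right D d))
    ((left D d <ᵇ left D c) ∧ (left D c <ᵇ right D d) ∧ (right D d <ᵇ right D c))
  irr : ∀ c → crosses D c c ≡ false
  irr c rewrite <ᵇ-irrefl (left D c) = refl

-- antisymmetric adjacency matrix of the oriented intersection graph:
-- the edge between chords i and j is oriented from the smaller to the larger number
orientedAdj : ∀ {n} → LinChordDiagram n → Fin n → Fin n → ℤ
orientedAdj D i j with crosses D i j | ⌊ i Fin.<? j ⌋
... | false | _     = ℤ.0ℤ
... | true  | true  = ℤ.1ℤ
... | true  | false = ℤ.-1ℤ

QChord : ∀ {n} → LinChordDiagram n → ℤ → ℤ
QChord {n} D u = detℤ n (λ i j → (if ⌊ i Fin.≟ j ⌋ then u else ℤ.0ℤ) ℤ.- orientedAdj D i j)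

record GraphIso {n m : ℕ} (G : SimpleGraph n) (H : SimpleGraph m) : Set where
  field
    σ        : Fin n ↔ Fin m
    preserve : ∀ i j → adj H (Inverse.to σ i) (Inverse.to σ j) ≡ adj G i j

-- Expanding det (u I - A) multilinearly in the rows gives the sum over vertex sets U of
-- u ^ (n - |U|) det (- A_U), with A_U the principal submatrix on U.  Now - A_U is the transpose
-- of the signed crossing matrix ε of the chord diagram formed by the chords in U, and the
-- determinant of such a crossing matrix is 0 or 1: if chord 0 crosses no chord, row 0 vanishes;
-- otherwise pivoting on chord 0 and a chord crossing it (a Schur complement with a pivot block of
-- determinant 1) yields the crossing matrix of a chord diagram with two chords fewer, obtained
-- by reversing the order of the three arcs cut out by the endpoints of the pivot chords.  An
-- integer in {0, 1} is determined by its parity, and modulo 2 the matrix ε is the adjacency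
-- matrix of the intersection graph, so det (- A_U) = ν (g(C)(U)).  Isomorphism invariance of
-- Q_G follows from its subset expansion, since a vertex bijection permutes the subsets and
-- conjugates the induced adjacency matrices by permutations.
module Submission where

open import Defs
open import Function using (_∘_; id)
open import Data.Nat as ℕ using (ℕ; zero; suc; _<_; _≤_; _<?_; _<ᵇ_; _∸_; _⊔_; s≤s)
import Data.Nat.Properties as ℕP
open import Data.Integer as ℤ using (ℤ; -_; _+_; _*_; _-_; 0ℤ; 1ℤ; -1ℤ; _^_; ∣_∣)
import Data.Integer.Properties as ℤP
open import Data.Integer.Tactic.RingSolver using (solve-∀)
open import Data.Fin as Fin using (Fin; zero; suc; punchIn; cast; toℕ)
import Data.Fin.Properties as FinP
open import Data.Fin.Permutation as Perm using (Permutation; _⟨$⟩ʳ_; _⟨$⟩ˡ_; remove)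
open import Data.Bool using (Bool; true; false; if_then_else_; not; _∧_; _xor_)
open import Data.Bool.Properties as BoolP
  using (not-involutive; not-distribˡ-xor; not-distribʳ-xor; true-xor; ∧-distribʳ-xor; xor-identityʳ; ∨-identityʳ)
open import Data.Vec as Vec using (Vec; []; _∷_; insertAt)
import Data.Vec.Properties as VecP
open import Data.List as List using (List; []; _∷_; _++_; length; lookup; filter)
import Data.List.Properties as ListP
open import Data.Product using (Σ; _×_; _,_; proj₁; proj₂)
open import Data.Sum using (_⊎_; inj₁; inj₂)
open import Data.Empty using (⊥-elim)
open import Data.Unit using (tt)
open import Relation.Nullary using (¬_; Dec; yes; no)
open import Relation.Nullary.Decidable using (⌊_⌋; True; toWitness; isYes≗does; dec-true; dec-false)
open import Relation.Binary using (Tri; tri<; tri≈; tri>)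
open import Relation.Binary.PropositionalEquality
open import Algebra.Properties.Semiring.Sum ℤP.+-*-semiring
  using (sum; sum-cong-≗; ∑-distrib-+; ∑-comm; sum-remove; sum-replicate-zero; *-distribˡ-sum)

-- Finite sums

sum-zero : ∀ {n} {f : Fin n → ℤ} → (∀ i → f i ≡ 0ℤ) → sum f ≡ 0ℤ
sum-zero {n} f≗0 = trans (sum-cong-≗ f≗0) (sum-replicate-zero n)

sum-single : ∀ {n} (k : Fin n) (f : Fin n → ℤ) → (∀ i → i ≢ k → f i ≡ 0ℤ) → sum f ≡ f k
sum-single {suc n} k f off = begin
  sum f                              ≡⟨ sum-remove {i = k} f ⟩
  f k + sum (f ∘ punchIn k)          ≡⟨ cong (f k +_) (sum-zero (λ j → off _ (FinP.punchInᵢ≢i k j))) ⟩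
  f k + 0ℤ                           ≡⟨ ℤP.+-identityʳ (f k) ⟩
  f k                                ∎
  where open ≡-Reasoning

sum-neg : ∀ {n} (f : Fin n → ℤ) → sum (λ i → - f i) ≡ - sum f
sum-neg {zero}  f = refl
sum-neg {suc n} f = trans (cong (- f zero +_) (sum-neg (f ∘ suc))) (sym (ℤP.neg-distrib-+ (f zero) _))

sum-linear : ∀ {n} (a b : ℤ) {f g h : Fin n → ℤ} → (∀ j → h j ≡ a * f j + b * g j) →
             sum h ≡ a * sum f + b * sum g
sum-linear a b {f} {g} {h} h≗ = begin
  sum h                                    ≡⟨ sum-cong-≗ h≗ ⟩
  sum (λ j → a * f j + b * g j)            ≡⟨ ∑-distrib-+ (λ j → a * f j) (λ j → b * g j) ⟩
  sum (λ j → a * f j) + sum (λ j → b * g j) ≡⟨ sym (cong₂ _+_ (*-distribˡ-sum a f) (*-distribˡ-sum b g)) ⟩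
  a * sum f + b * sum g                    ∎
  where open ≡-Reasoning

sumList : ∀ {A : Set} → (A → ℤ) → List A → ℤ
sumList f = sumℤ ∘ List.map f

sumList-cong : ∀ {A : Set} {f g : A → ℤ} xs → (∀ a → f a ≡ g a) → sumList f xs ≡ sumList g xs
sumList-cong []       f≗g = refl
sumList-cong (a ∷ xs) f≗g = cong₂ _+_ (f≗g a) (sumList-cong xs f≗g)

sumList-++ : ∀ {A : Set} (f : A → ℤ) xs ys → sumList f (xs ++ ys) ≡ sumList f xs + sumList f ys
sumList-++ f []       ys = sym (ℤP.+-identityˡ _)
sumList-++ f (a ∷ xs) ys = trans (cong (f a +_) (sumList-++ f xs ys)) (sym (ℤP.+-assoc (f a) _ _))

sumList-map : ∀ {A B : Set} (f : B → ℤ) (g : A → B) xs → sumList f (List.map g xs) ≡ sumList (f ∘ g) xs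
sumList-map f g []       = refl
sumList-map f g (a ∷ xs) = cong (f (g a) +_) (sumList-map f g xs)

sumList-+ : ∀ {A : Set} (f g : A → ℤ) xs → sumList (λ a → f a + g a) xs ≡ sumList f xs + sumList g xs
sumList-+ f g []       = refl
sumList-+ f g (a ∷ xs) = trans (cong (f a + g a +_) (sumList-+ f g xs)) (swap (f a) (g a) _ _)
  where swap : ∀ a b c d → a + b + (c + d) ≡ a + c + (b + d)
        swap = solve-∀

*-distribˡ-sumList : ∀ {A : Set} (c : ℤ) (f : A → ℤ) xs → c * sumList f xs ≡ sumList (λ a → c * f a) xs
*-distribˡ-sumList c f []       = ℤP.*-zeroʳ c
*-distribˡ-sumList c f (a ∷ xs) = trans (ℤP.*-distribˡ-+ c (f a) _) (cong (c * f a +_) (*-distribˡ-sumList c f xs))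

sumList-zero : ∀ {A : Set} {f : A → ℤ} xs → (∀ a → f a ≡ 0ℤ) → sumList f xs ≡ 0ℤ
sumList-zero []       f≗0 = refl
sumList-zero (a ∷ xs) f≗0 = cong₂ _+_ (f≗0 a) (sumList-zero xs f≗0)

sum-sumList : ∀ {A : Set} {n} (h : Fin n → A → ℤ) xs →
              sum (λ j → sumList (h j) xs) ≡ sumList (λ a → sum (λ j → h j a)) xs
sum-sumList {n = n} h []       = sum-replicate-zero n
sum-sumList         h (a ∷ xs) = trans (∑-distrib-+ (λ j → h j a) _) (cong (sum (λ j → h j a) +_) (sum-sumList h xs))

sumList-subsets-suc : ∀ {n} (f : Vec Bool (suc n) → ℤ) →
  sumList f (subsets (suc n)) ≡ sumList (f ∘ (true ∷_)) (subsets n) + sumList (f ∘ (false ∷_)) (subsets n)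
sumList-subsets-suc {n} f = trans (sumList-++ f (List.map (true ∷_) (subsets n)) _)
  (cong₂ _+_ (sumList-map f (true ∷_) (subsets n)) (sumList-map f (false ∷_) (subsets n)))

sumList-subsets-only-∅ : ∀ {n} (f : Vec Bool n → ℤ) →
  (∀ U i → Vec.lookup U i ≡ true → f U ≡ 0ℤ) → sumList f (subsets n) ≡ f (Vec.replicate n false)
sumList-subsets-only-∅ {zero}  f vanish = ℤP.+-identityʳ _
sumList-subsets-only-∅ {suc n} f vanish = begin
  sumList f (subsets (suc n))
    ≡⟨ sumList-subsets-suc f ⟩
  sumList (f ∘ (true ∷_)) (subsets n) + sumList (f ∘ (false ∷_)) (subsets n)
    ≡⟨ cong₂ _+_ (sumList-zero (subsets n) (λ U → vanish (true ∷ U) zero refl))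
                 (sumList-subsets-only-∅ (f ∘ (false ∷_)) (λ U i → vanish (false ∷ U) (suc i))) ⟩
  0ℤ + f (false ∷ Vec.replicate n false)
    ≡⟨ ℤP.+-identityˡ _ ⟩
  f (Vec.replicate (suc n) false) ∎
  where open ≡-Reasoning

-- Determinants

Matrix : ℕ → Set
Matrix n = Fin n → Fin n → ℤ

sgn : ∀ {n} → Fin n → ℤ
sgn zero    = 1ℤ
sgn (suc j) = - sgn j

sgn² : ∀ {n} (j : Fin n) → sgn j * sgn j ≡ 1ℤ
sgn² zero    = refl
sgn² (suc j) = trans (neg-square (sgn j)) (sgn² j)
  where neg-square : ∀ a → - a * - a ≡ a * a
        neg-square = solve-∀

minor : ∀ {n} → Fin (suc n) → Fin (suc n) → Matrix (suc n) → Matrix n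
minor i k M r c = M (punchIn i r) (punchIn k c)

det : ∀ n → Matrix n → ℤ
det zero    M = 1ℤ
det (suc n) M = sum λ k → sgn k * (M zero k * det n (minor zero k M))

cofactor : ∀ {n} → Fin (suc n) → Fin (suc n) → Matrix (suc n) → ℤ
cofactor {n} i k M = sgn i * sgn k * det n (minor i k M)

transpose : ∀ {n} → Matrix n → Matrix n
transpose M r c = M c r

detℤ≡det : ∀ n M → detℤ n M ≡ det n M
detℤ≡det zero    M = refl
detℤ≡det (suc n) M = sumFin≡sum λ k → cong₂ _*_ (sgn≡sgn k) (cong (M zero k *_) (detℤ≡det n (minor zero k M)))
  where
  module DZ = Det ℤ-rawRing
  sgn≡sgn : ∀ {m} (j : Fin m) → DZ.sgn j ≡ sgn j
  sgn≡sgn zero    = refl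
  sgn≡sgn (suc j) = cong -_ (sgn≡sgn j)
  sumFin≡sum : ∀ {m} {f g : Fin m → ℤ} → (∀ j → f j ≡ g j) → DZ.sumFin f ≡ sum g
  sumFin≡sum {zero}  f≗g = refl
  sumFin≡sum {suc m} f≗g = cong₂ _+_ (f≗g zero) (sumFin≡sum (f≗g ∘ suc))

det-cong : ∀ n {M N : Matrix n} → (∀ r c → M r c ≡ N r c) → det n M ≡ det n N
det-cong zero    M≗N = refl
det-cong (suc n) M≗N = sum-cong-≗ λ k →
  cong₂ (λ a d → sgn k * (a * d)) (M≗N zero k) (det-cong n λ r c → M≗N (suc r) (punchIn k c))

private
  term≡0ˡ : ∀ s {a} d → a ≡ 0ℤ → s * (a * d) ≡ 0ℤ
  term≡0ˡ s d refl = ℤP.*-zeroʳ s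

  term≡0ʳ : ∀ s a {d} → d ≡ 0ℤ → s * (a * d) ≡ 0ℤ
  term≡0ʳ s a refl = trans (cong (s *_) (ℤP.*-zeroʳ a)) (ℤP.*-zeroʳ s)

det-zeroRow : ∀ n (i : Fin n) (M : Matrix n) → (∀ c → M i c ≡ 0ℤ) → det n M ≡ 0ℤ
det-zeroRow (suc n) zero    M row≡0 = sum-zero λ k → term≡0ˡ (sgn k) (det n (minor zero k M)) (row≡0 k)
det-zeroRow (suc n) (suc i) M row≡0 = sum-zero λ k →
  term≡0ʳ (sgn k) (M zero k) (det-zeroRow n i (minor zero k M) (row≡0 ∘ punchIn k))

det-linearRow : ∀ n (i : Fin n) (a b : ℤ) {M N P : Matrix n} →
  (∀ r → r ≢ i → ∀ c → P r c ≡ M r c) → (∀ r → r ≢ i → ∀ c → P r c ≡ N r c) →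
  (∀ c → P i c ≡ a * M i c + b * N i c) → det n P ≡ a * det n M + b * det n N
det-linearRow (suc n) zero a b {M} {N} {P} P≗M P≗N Pᵢ = sum-linear a b λ k → begin
  sgn k * (P zero k * det n (minor zero k P))
    ≡⟨ cong (λ x → sgn k * (x * det n (minor zero k P))) (Pᵢ k) ⟩
  sgn k * ((a * M zero k + b * N zero k) * det n (minor zero k P))
    ≡⟨ distrib (sgn k) (M zero k) (N zero k) (det n (minor zero k P)) a b ⟩
  a * (sgn k * (M zero k * det n (minor zero k P))) + b * (sgn k * (N zero k * det n (minor zero k P)))
    ≡⟨ cong₂ (λ d e → a * (sgn k * (M zero k * d)) + b * (sgn k * (N zero k * e)))
         (det-cong n λ r c → P≗M (suc r) (λ ()) _) (det-cong n λ r c → P≗N (suc r) (λ ()) _) ⟩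
  a * (sgn k * (M zero k * det n (minor zero k M))) + b * (sgn k * (N zero k * det n (minor zero k N))) ∎
  where
  open ≡-Reasoning
  distrib : ∀ s x y d a b → s * ((a * x + b * y) * d) ≡ a * (s * (x * d)) + b * (s * (y * d))
  distrib = solve-∀
det-linearRow (suc n) (suc i) a b {M} {N} {P} P≗M P≗N Pᵢ = sum-linear a b λ k → begin
  sgn k * (P zero k * det n (minor zero k P))
    ≡⟨ cong (λ d → sgn k * (P zero k * d)) (det-linearRow n i a b
         (λ r r≢i c → P≗M (suc r) (r≢i ∘ FinP.suc-injective) _)
         (λ r r≢i c → P≗N (suc r) (r≢i ∘ FinP.suc-injective) _) (Pᵢ ∘ punchIn k)) ⟩
  sgn k * (P zero k * (a * det n (minor zero k M) + b * det n (minor zero k N)))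
    ≡⟨ distrib (sgn k) (P zero k) a b (det n (minor zero k M)) (det n (minor zero k N)) ⟩
  a * (sgn k * (P zero k * det n (minor zero k M))) + b * (sgn k * (P zero k * det n (minor zero k N)))
    ≡⟨ cong₂ (λ x y → a * (sgn k * (x * det n (minor zero k M))) + b * (sgn k * (y * det n (minor zero k N))))
         (P≗M zero (λ ()) k) (P≗N zero (λ ()) k) ⟩
  a * (sgn k * (M zero k * det n (minor zero k M))) + b * (sgn k * (N zero k * det n (minor zero k N))) ∎
  where
  open ≡-Reasoning
  distrib : ∀ s x a b u v → s * (x * (a * u + b * v)) ≡ a * (s * (x * u)) + b * (s * (x * v))
  distrib = solve-∀

scalarMatrix : ∀ n → ℤ → Matrix n
scalarMatrix n u i j = if ⌊ i Fin.≟ j ⌋ then u else 0ℤ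

scalarMatrix-diag : ∀ {n} u (i : Fin n) → scalarMatrix n u i i ≡ u
scalarMatrix-diag u i with i Fin.≟ i
... | yes _   = refl
... | no i≢i = ⊥-elim (i≢i refl)

scalarMatrix-offDiag : ∀ {n} u {i j : Fin n} → i ≢ j → scalarMatrix n u i j ≡ 0ℤ
scalarMatrix-offDiag u {i} {j} i≢j with i Fin.≟ j
... | yes i≡j = ⊥-elim (i≢j i≡j)
... | no _    = refl

setRow : ∀ {n} → Fin n → (Fin n → ℤ) → Matrix n → Matrix n
setRow i v M r with r Fin.≟ i
... | yes _ = v
... | no  _ = M r

setRow-≡ : ∀ {n} i v (M : Matrix n) c → setRow i v M i c ≡ v c
setRow-≡ i v M c with i Fin.≟ i
... | yes _   = refl
... | no i≢i = ⊥-elim (i≢i refl)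

setRow-≢ : ∀ {n} {i r} v (M : Matrix n) → r ≢ i → ∀ c → setRow i v M r c ≡ M r c
setRow-≢ {i = i} {r} v M r≢i c with r Fin.≟ i
... | yes r≡i = ⊥-elim (r≢i r≡i)
... | no _    = refl

-- coPunch k j is the position of column k once column punchIn k j has been deleted.
coPunch : ∀ {n} → Fin (suc (suc n)) → Fin (suc n) → Fin (suc n)
coPunch         zero    j       = zero
coPunch         (suc k) zero    = k
coPunch {suc n} (suc k) (suc j) = suc (coPunch k j)

punchIn-coPunch : ∀ {n} (k : Fin (suc (suc n))) j → punchIn (punchIn k j) (coPunch k j) ≡ k
punchIn-coPunch         zero    j       = refl
punchIn-coPunch         (suc k) zero    = refl
punchIn-coPunch {suc n} (suc k) (suc j) = cong suc (punchIn-coPunch k j)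

punchIn-punchIn-coPunch : ∀ {n} (k : Fin (suc (suc n))) j c →
  punchIn (punchIn k j) (punchIn (coPunch k j) c) ≡ punchIn k (punchIn j c)
punchIn-punchIn-coPunch         zero    j       c       = refl
punchIn-punchIn-coPunch         (suc k) zero    c       = refl
punchIn-punchIn-coPunch {suc n} (suc k) (suc j) zero    = refl
punchIn-punchIn-coPunch {suc n} (suc k) (suc j) (suc c) = cong suc (punchIn-punchIn-coPunch k j c)

sgn-coPunch : ∀ {n} (k : Fin (suc (suc n))) j → sgn (punchIn k j) * sgn (coPunch k j) ≡ - (sgn k * sgn j)
sgn-coPunch         zero    j       = ring₁ (sgn j)
  where ring₁ : ∀ a → - a * 1ℤ ≡ - (1ℤ * a)
        ring₁ = solve-∀
sgn-coPunch         (suc k) zero    = ring₂ (sgn k)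
  where ring₂ : ∀ a → 1ℤ * a ≡ - (- a * 1ℤ)
        ring₂ = solve-∀
sgn-coPunch {suc n} (suc k) (suc j) = trans (neg-square (sgn (punchIn k j)) (sgn (coPunch k j)))
  (trans (sgn-coPunch k j) (cong -_ (sym (neg-square (sgn k) (sgn j)))))
  where neg-square : ∀ a b → - a * - b ≡ a * b
        neg-square = solve-∀

det-unitRow : ∀ n (i k : Fin (suc n)) (d : ℤ) (M : Matrix (suc n)) →
  M i k ≡ d → (∀ c → c ≢ k → M i c ≡ 0ℤ) → det (suc n) M ≡ d * cofactor i k M
det-unitRow n zero k d M Mᵢₖ Mᵢ≡0 = begin
  det (suc n) M
    ≡⟨ sum-single k _ (λ c c≢k → term≡0ˡ (sgn c) (det n (minor zero c M)) (Mᵢ≡0 c c≢k)) ⟩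
  sgn k * (M zero k * det n (minor zero k M))
    ≡⟨ cong (λ x → sgn k * (x * det n (minor zero k M))) Mᵢₖ ⟩
  sgn k * (d * det n (minor zero k M))
    ≡⟨ reorder (sgn k) d (det n (minor zero k M)) ⟩
  d * cofactor zero k M ∎
  where
  open ≡-Reasoning
  reorder : ∀ s d D → s * (d * D) ≡ d * (1ℤ * s * D)
  reorder = solve-∀
det-unitRow (suc n) (suc i) k d M Mᵢₖ Mᵢ≡0 = begin
  det (suc (suc n)) M
    ≡⟨ sum-remove {i = k} term ⟩
  term k + sum (term ∘ punchIn k)
    ≡⟨ cong₂ _+_ term-k≡0 (sum-cong-≗ term-punchIn) ⟩
  0ℤ + sum (λ j → c * g j)
    ≡⟨ ℤP.+-identityˡ (sum (λ j → c * g j)) ⟩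
  sum (λ j → c * g j)
    ≡⟨ *-distribˡ-sum c g ⟨
  c * det (suc n) Mᵢₖ′
    ≡⟨ ℤP.*-assoc d (sgn (suc i) * sgn k) (det (suc n) Mᵢₖ′) ⟩
  d * cofactor (suc i) k M ∎
  where
  open ≡-Reasoning
  Mᵢₖ′ = minor (suc i) k M
  c = d * (sgn (suc i) * sgn k)
  term : Fin (suc (suc n)) → ℤ
  term j = sgn j * (M zero j * det (suc n) (minor zero j M))
  g : Fin (suc n) → ℤ
  g j = sgn j * (M zero (punchIn k j) * det n (minor zero j Mᵢₖ′))
  term-k≡0 : term k ≡ 0ℤ
  term-k≡0 = term≡0ʳ (sgn k) (M zero k) (det-zeroRow (suc n) i (minor zero k M) (λ c → Mᵢ≡0 (punchIn k c) (FinP.punchInᵢ≢i k c)))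
  term-punchIn : ∀ j → term (punchIn k j) ≡ c * g j
  term-punchIn j = begin
    sgn j′ * (M zero j′ * det (suc n) (minor zero j′ M))
      ≡⟨ cong (λ D → sgn j′ * (M zero j′ * D)) (det-unitRow n i k′ d (minor zero j′ M)
           (trans (cong (M (suc i)) (punchIn-coPunch k j)) Mᵢₖ)
           (λ c c≢k′ → Mᵢ≡0 _ (c≢k′ ∘ λ eq → FinP.punchIn-injective j′ c k′ (trans eq (sym (punchIn-coPunch k j)))))) ⟩
    sgn j′ * (M zero j′ * (d * (sgn i * sgn k′ * det n (minor i k′ (minor zero j′ M)))))
      ≡⟨ reorder (sgn j′) (sgn k′) (M zero j′) d (sgn i) (det n (minor i k′ (minor zero j′ M))) ⟩
    (sgn j′ * sgn k′) * (d * sgn i * (M zero j′ * det n (minor i k′ (minor zero j′ M))))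
      ≡⟨ cong₂ (λ s D → s * (d * sgn i * (M zero j′ * D))) (sgn-coPunch k j)
           (det-cong n λ r c → cong (M (suc (punchIn i r))) (punchIn-punchIn-coPunch k j c)) ⟩
    - (sgn k * sgn j) * (d * sgn i * (M zero j′ * det n (minor zero j Mᵢₖ′)))
      ≡⟨ reorder′ (sgn k) (sgn j) (M zero j′) d (sgn i) (det n (minor zero j Mᵢₖ′)) ⟩
    (d * (sgn (suc i) * sgn k)) * (sgn j * (M zero j′ * det n (minor zero j Mᵢₖ′))) ∎
    where
    j′ = punchIn k j
    k′ = coPunch k j
    reorder : ∀ p q x d s D → p * (x * (d * (s * q * D))) ≡ (p * q) * (d * s * (x * D))
    reorder = solve-∀
    reorder′ : ∀ p q x d s D → - (p * q) * (d * s * (x * D)) ≡ (d * (- s * p)) * (q * (x * D))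
    reorder′ = solve-∀

det-sumRows : ∀ n (i : Fin n) {m} (F : Fin m → Matrix n) (P : Matrix n) →
  (∀ k r → r ≢ i → ∀ c → F k r c ≡ P r c) → (∀ c → P i c ≡ sum (λ k → F k i c)) →
  det n P ≡ sum (λ k → det n (F k))
det-sumRows n i {zero}  F P F≗P Pᵢ = det-zeroRow n i P Pᵢ
det-sumRows n i {suc m} F P F≗P Pᵢ = begin
  det n P
    ≡⟨ det-linearRow n i 1ℤ 1ℤ (λ r r≢i c → sym (F≗P zero r r≢i c)) (λ r r≢i c → sym (setRow-≢ rest P r≢i c))
                     Pᵢ′ ⟩
  1ℤ * det n (F zero) + 1ℤ * det n Q
    ≡⟨ cong₂ _+_ (ℤP.*-identityˡ (det n (F zero))) (trans (ℤP.*-identityˡ (det n Q)) (det-sumRows n i (F ∘ suc) Q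
         (λ k r r≢i c → trans (F≗P (suc k) r r≢i c) (sym (setRow-≢ rest P r≢i c))) (setRow-≡ i rest P))) ⟩
  det n (F zero) + sum (λ k → det n (F (suc k))) ∎
  where
  open ≡-Reasoning
  rest : Fin n → ℤ
  rest c = sum (λ k → F (suc k) i c)
  Q = setRow i rest P
  Pᵢ′ : ∀ c → P i c ≡ 1ℤ * F zero i c + 1ℤ * Q i c
  Pᵢ′ c = trans (Pᵢ c) (sym (cong₂ _+_ (ℤP.*-identityˡ (F zero i c)) (trans (ℤP.*-identityˡ (Q i c)) (setRow-≡ i rest P c))))

det-expandRow : ∀ n (i : Fin (suc n)) (M : Matrix (suc n)) → det (suc n) M ≡ sum λ k → M i k * cofactor i k M
det-expandRow n i M = begin
  det (suc n) M
    ≡⟨ det-sumRows (suc n) i F M (λ k r r≢i c → setRow-≢ (unit k) M r≢i c) Mᵢ ⟩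
  sum (λ k → det (suc n) (F k))
    ≡⟨ sum-cong-≗ (λ k → det-unitRow n i k (M i k) (F k)
         (trans (setRow-≡ i (unit k) M k) (scalarMatrix-diag (M i k) k))
         (λ c c≢k → trans (setRow-≡ i (unit k) M c) (scalarMatrix-offDiag (M i k) c≢k))) ⟩
  sum (λ k → M i k * cofactor i k (F k))
    ≡⟨ sum-cong-≗ (λ k → cong (λ D → M i k * (sgn i * sgn k * D))
         (det-cong n λ r c → setRow-≢ (unit k) M (FinP.punchInᵢ≢i i r) (punchIn k c))) ⟩
  sum (λ k → M i k * cofactor i k M) ∎
  where
  open ≡-Reasoning
  unit : Fin (suc n) → Fin (suc n) → ℤ
  unit k c = scalarMatrix (suc n) (M i k) c k
  F : Fin (suc n) → Matrix (suc n)
  F k = setRow i (unit k) M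
  Mᵢ : ∀ c → M i c ≡ sum (λ k → F k i c)
  Mᵢ c = sym (begin
    sum (λ k → F k i c)  ≡⟨ sum-cong-≗ (λ k → setRow-≡ i (unit k) M c) ⟩
    sum (λ k → unit k c) ≡⟨ sum-single c (λ k → unit k c) (λ k k≢c → scalarMatrix-offDiag (M i k) (k≢c ∘ sym)) ⟩
    unit c c             ≡⟨ scalarMatrix-diag (M i c) c ⟩
    M i c ∎)

private
  i≡-i⇒i≡0 : ∀ {i} → i ≡ - i → i ≡ 0ℤ
  i≡-i⇒i≡0 {ℤ.+ zero} _ = refl

det-equalRows₀ : ∀ n (M : Matrix (suc n)) (q : Fin n) → (∀ c → M zero c ≡ M (suc q) c) → det (suc n) M ≡ 0ℤ
det-equalRows₀ (suc n) M zero M₀≡M₁ = i≡-i⇒i≡0 (begin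
  det (suc (suc n)) M
    ≡⟨ det-expandRow (suc n) (suc zero) M ⟩
  sum (λ k → M (suc zero) k * cofactor (suc zero) k M)
    ≡⟨ sum-cong-≗ (λ k → cong₂ (λ x D → x * (- 1ℤ * sgn k * D)) (sym (M₀≡M₁ k)) (det-cong (suc n) (rows k))) ⟩
  sum (λ k → M zero k * (- 1ℤ * sgn k * det (suc n) (minor zero k M)))
    ≡⟨ sum-cong-≗ (λ k → reorder (M zero k) (sgn k) (det (suc n) (minor zero k M))) ⟩
  sum (λ k → - (sgn k * (M zero k * det (suc n) (minor zero k M))))
    ≡⟨ sum-neg (λ k → sgn k * (M zero k * det (suc n) (minor zero k M))) ⟩
  - det (suc (suc n)) M ∎)
  where
  open ≡-Reasoning
  reorder : ∀ x s D → x * (- 1ℤ * s * D) ≡ - (s * (x * D))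
  reorder = solve-∀
  rows : ∀ k r c → minor (suc zero) k M r c ≡ minor zero k M r c
  rows k zero    c = M₀≡M₁ (punchIn k c)
  rows k (suc r) c = refl
det-equalRows₀ (suc n) M (suc q) M₀≡Mq = begin
  det (suc (suc n)) M
    ≡⟨ det-expandRow (suc n) (suc zero) M ⟩
  sum (λ k → M (suc zero) k * cofactor (suc zero) k M)
    ≡⟨ sum-zero (λ k → term≡0ʳ (M (suc zero) k) (sgn (suc (zero {n})) * sgn k)
                             (det-equalRows₀ n (minor (suc zero) k M) q (M₀≡Mq ∘ punchIn k))) ⟩
  0ℤ ∎
  where open ≡-Reasoning

det-equalRows : ∀ n (M : Matrix n) {p q : Fin n} → p ≢ q → (∀ c → M p c ≡ M q c) → det n M ≡ 0ℤ
det-equalRows (suc n) M {zero}  {zero}  p≢q _     = ⊥-elim (p≢q refl)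
det-equalRows (suc n) M {zero}  {suc q} _   Mp≡Mq = det-equalRows₀ n M q Mp≡Mq
det-equalRows (suc n) M {suc p} {zero}  _   Mp≡Mq = det-equalRows₀ n M p (sym ∘ Mp≡Mq)
det-equalRows (suc n) M {suc p} {suc q} p≢q Mp≡Mq = sum-zero λ k →
  term≡0ʳ (sgn k) (M zero k) (det-equalRows n (minor zero k M) (p≢q ∘ cong suc) (Mp≡Mq ∘ punchIn k))

det-proportionalRows : ∀ n (M : Matrix n) {i p : Fin n} (a : ℤ) → i ≢ p →
  (∀ c → M i c ≡ a * M p c) → det n M ≡ 0ℤ
det-proportionalRows n M {i} {p} a i≢p Mᵢ = begin
  det n M
    ≡⟨ det-linearRow n i a 0ℤ (λ r r≢i c → sym (setRow-≢ (M p) M r≢i c)) (λ r r≢i c → sym (setRow-≢ (M p) M r≢i c))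
         (λ c → trans (Mᵢ c) (sym (trans (cong (λ x → a * x + 0ℤ) (setRow-≡ i (M p) M c)) (ℤP.+-identityʳ (a * M p c))))) ⟩
  a * det n M′ + 0ℤ
    ≡⟨ cong (λ D → a * D + 0ℤ) (det-equalRows n M′ i≢p λ c →
         trans (setRow-≡ i (M p) M c) (sym (setRow-≢ (M p) M (i≢p ∘ sym) c))) ⟩
  a * 0ℤ + 0ℤ
    ≡⟨ cong (_+ 0ℤ) (ℤP.*-zeroʳ a) ⟩
  0ℤ ∎
  where
  open ≡-Reasoning
  M′ = setRow i (M p) M

det-expandCol₀ : ∀ n (M : Matrix (suc n)) → det (suc n) M ≡ sum (λ k → sgn k * (M k zero * det n (minor k zero M)))
det-expandCol₀ zero    M = refl
det-expandCol₀ (suc n) M = cong (sgn {suc (suc n)} zero * (M zero zero * det (suc n) (minor zero zero M)) +_) (begin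
  sum (λ j → sgn (suc j) * (M zero (suc j) * det (suc n) (minor zero (suc j) M)))
    ≡⟨ sum-cong-≗ (λ j → cong (λ D → sgn (suc j) * (M zero (suc j) * D)) (det-expandCol₀ n (minor zero (suc j) M))) ⟩
  sum (λ j → sgn (suc j) * (M zero (suc j) * sum (λ r → sgn r * (M (suc r) zero * det n (X j r)))))
    ≡⟨ sum-cong-≗ (λ j → pull (sgn (suc j)) (M zero (suc j)) (λ r → sgn r * (M (suc r) zero * det n (X j r)))) ⟩
  sum (λ j → sum (λ r → sgn (suc j) * (M zero (suc j) * (sgn r * (M (suc r) zero * det n (X j r))))))
    ≡⟨ ∑-comm (λ j r → sgn (suc j) * (M zero (suc j) * (sgn r * (M (suc r) zero * det n (X j r))))) ⟩
  sum (λ r → sum (λ j → sgn (suc j) * (M zero (suc j) * (sgn r * (M (suc r) zero * det n (X j r))))))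
    ≡⟨ sum-cong-≗ (λ r → sum-cong-≗ (λ j → reorder (sgn j) (sgn r) (M zero (suc j)) (M (suc r) zero) (det n (X j r)))) ⟩
  sum (λ r → sum (λ j → sgn (suc r) * (M (suc r) zero * (sgn j * (M zero (suc j) * det n (X j r))))))
    ≡⟨ sum-cong-≗ (λ r → sym (pull (sgn (suc r)) (M (suc r) zero) (λ j → sgn j * (M zero (suc j) * det n (X j r))))) ⟩
  sum (λ r → sgn (suc r) * (M (suc r) zero * sum (λ j → sgn j * (M zero (suc j) * det n (X j r))))) ∎)
  where
  open ≡-Reasoning
  X : Fin (suc n) → Fin (suc n) → Matrix n
  X j r = minor r zero (minor zero (suc j) M)
  reorder : ∀ a b m₁ m₂ D → - a * (m₁ * (b * (m₂ * D))) ≡ - b * (m₂ * (a * (m₁ * D)))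
  reorder = solve-∀
  pull : ∀ a b (f : Fin (suc n) → ℤ) → a * (b * sum f) ≡ sum (λ r → a * (b * f r))
  pull a b f = trans (cong (a *_) (*-distribˡ-sum b f)) (*-distribˡ-sum a (λ r → b * f r))

det-transpose : ∀ n (M : Matrix n) → det n (transpose M) ≡ det n M
det-transpose zero    M = refl
det-transpose (suc n) M = trans
  (sum-cong-≗ λ k → cong (λ D → sgn k * (M k zero * D)) (det-transpose n (minor k zero M)))
  (sym (det-expandCol₀ n M))

mix : ∀ {n} → Vec Bool n → Matrix n → Matrix n → Matrix n
mix U X Y r c = if Vec.lookup U r then Y r c else X r c

det-mix : ∀ n (X Y : Matrix n) → det n (λ r c → X r c + Y r c) ≡ sumList (λ U → det n (mix U X Y)) (subsets n)
det-mix zero    X Y = refl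
det-mix (suc n) X Y = begin
  sum (λ k → sgn k * ((X zero k + Y zero k) * det n (minor zero k (λ r c → X r c + Y r c))))
    ≡⟨ sum-cong-≗ (λ k → cong (λ D → sgn k * ((X zero k + Y zero k) * D)) (det-mix n (minor zero k X) (minor zero k Y))) ⟩
  sum (λ k → sgn k * ((X zero k + Y zero k) * sumList (D k) (subsets n)))
    ≡⟨ sum-cong-≗ (λ k → expand (sgn k) (X zero k) (Y zero k) (D k) (subsets n)) ⟩
  sum (λ k → sumList (λ U → term Y U k + term X U k) (subsets n))
    ≡⟨ sum-sumList (λ k U → term Y U k + term X U k) (subsets n) ⟩
  sumList (λ U → sum (λ k → term Y U k + term X U k)) (subsets n)
    ≡⟨ sumList-cong (subsets n) (λ U → ∑-distrib-+ (term Y U) (term X U)) ⟩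
  sumList (λ U → det (suc n) (mix (true ∷ U) X Y) + det (suc n) (mix (false ∷ U) X Y)) (subsets n)
    ≡⟨ sumList-+ (λ U → det (suc n) (mix (true ∷ U) X Y)) (λ U → det (suc n) (mix (false ∷ U) X Y)) (subsets n) ⟩
  sumList (λ U → det (suc n) (mix (true ∷ U) X Y)) (subsets n) + sumList (λ U → det (suc n) (mix (false ∷ U) X Y)) (subsets n)
    ≡⟨ sym (sumList-subsets-suc (λ U → det (suc n) (mix U X Y))) ⟩
  sumList (λ U → det (suc n) (mix U X Y)) (subsets (suc n)) ∎
  where
  open ≡-Reasoning
  D : Fin (suc n) → Vec Bool n → ℤ
  D k U = det n (mix U (minor zero k X) (minor zero k Y))
  term : Matrix (suc n) → Vec Bool n → Fin (suc n) → ℤ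
  term Z U k = sgn k * (Z zero k * D k U)
  expand : ∀ s x y (g : Vec Bool n → ℤ) xs → s * ((x + y) * sumList g xs) ≡ sumList (λ U → s * (y * g U) + s * (x * g U)) xs
  expand s x y g xs = trans (cong (s *_) (*-distribˡ-sumList (x + y) g xs))
    (trans (*-distribˡ-sumList s (λ U → (x + y) * g U) xs) (sumList-cong xs λ U → distrib s x y (g U)))
    where distrib : ∀ s x y G → s * ((x + y) * G) ≡ s * (y * G) + s * (x * G)
          distrib = solve-∀

det-addRowMultiples : ∀ n (M : Matrix n) (p : Fin n) (a : Fin n → ℤ) → a p ≡ 0ℤ →
  det n (λ r c → M r c + a r * M p c) ≡ det n M
det-addRowMultiples n M p a aₚ≡0 = begin
  det n (λ r c → M r c + Y r c)
    ≡⟨ det-mix n M Y ⟩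
  sumList (λ U → det n (mix U M Y)) (subsets n)
    ≡⟨ sumList-subsets-only-∅ (λ U → det n (mix U M Y)) vanish ⟩
  det n (mix (Vec.replicate n false) M Y)
    ≡⟨ det-cong n (λ r c → cong (λ b → mix′ b r c) (VecP.lookup-replicate r false)) ⟩
  det n M ∎
  where
  open ≡-Reasoning
  Y : Matrix n
  Y r c = a r * M p c
  mix′ : Bool → Fin n → Fin n → ℤ
  mix′ b r c = if b then Y r c else M r c
  Yₚ≡0 : ∀ c → Y p c ≡ 0ℤ
  Yₚ≡0 c = trans (cong (_* M p c) aₚ≡0) (ℤP.*-zeroˡ (M p c))
  vanish : ∀ U i → Vec.lookup U i ≡ true → det n (mix U M Y) ≡ 0ℤ
  vanish U i Uᵢ with Vec.lookup U p in Uₚ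
  ... | true  = det-zeroRow n p (mix U M Y) λ c → trans (cong (λ b → mix′ b p c) Uₚ) (Yₚ≡0 c)
  ... | false = det-proportionalRows n (mix U M Y) (a i) i≢p λ c →
                  trans (cong (λ b → mix′ b i c) Uᵢ) (cong (a i *_) (sym (cong (λ b → mix′ b p c) Uₚ)))
    where i≢p : i ≢ p
          i≢p refl with trans (sym Uᵢ) Uₚ
          ... | ()

det-addColMultiples : ∀ n (M : Matrix n) (p : Fin n) (a : Fin n → ℤ) → a p ≡ 0ℤ →
  det n (λ r c → M r c + a c * M r p) ≡ det n M
det-addColMultiples n M p a aₚ≡0 = begin
  det n (λ r c → M r c + a c * M r p)
    ≡⟨ sym (det-transpose n (λ r c → M r c + a c * M r p)) ⟩
  det n (λ r c → transpose M r c + a r * transpose M p c)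
    ≡⟨ det-addRowMultiples n (transpose M) p a aₚ≡0 ⟩
  det n (transpose M)
    ≡⟨ det-transpose n M ⟩
  det n M ∎
  where open ≡-Reasoning

-- The Schur complement of the block on rows and columns 0 and suc j: when that block is
-- [[0, x], [-x, 0]] with x² = 1, its inverse is [[0, -x], [x, 0]], which gives this formula.
pivot : ∀ {m} → Matrix (suc (suc m)) → Fin (suc m) → Matrix m
pivot M j r c = M (ι r) (ι c) - M zero (suc j) * (M zero (ι c) * M (ι r) (suc j) - M (suc j) (ι c) * M (ι r) zero)
  where ι = suc ∘ punchIn j

det-pivot : ∀ m (M : Matrix (suc (suc m))) (j : Fin (suc m)) →
  M zero zero ≡ 0ℤ → M (suc j) (suc j) ≡ 0ℤ → M zero (suc j) * M zero (suc j) ≡ 1ℤ → M (suc j) zero ≡ - M zero (suc j) →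
  det (suc (suc m)) M ≡ det m (pivot M j)
det-pivot m M j M₀₀≡0 Mⱼⱼ≡0 M₀ⱼ²≡1 Mⱼ₀≡-M₀ⱼ = begin
  det (suc (suc m)) M
    ≡⟨ sym (det-addColMultiples (suc (suc m)) M ĵ a₁ a₁ĵ≡0) ⟩
  det (suc (suc m)) M₁
    ≡⟨ sym (det-addColMultiples (suc (suc m)) M₁ zero a₂ refl) ⟩
  det (suc (suc m)) M₂
    ≡⟨ det-unitRow (suc m) zero ĵ x M₂ M₂₀ⱼ M₂₀≡0 ⟩
  x * (1ℤ * sgn ĵ * det (suc m) N)
    ≡⟨ cong (λ D → x * (1ℤ * sgn ĵ * D)) (det-unitRow m j zero (M ĵ zero) N Nⱼ₀ Nⱼ≡0) ⟩
  x * (1ℤ * sgn ĵ * (M ĵ zero * (sgn j * 1ℤ * det m (minor j zero N))))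
    ≡⟨ cong (λ y → x * (1ℤ * sgn ĵ * (y * (sgn j * 1ℤ * det m (minor j zero N))))) Mⱼ₀≡-M₀ⱼ ⟩
  x * (1ℤ * - sgn j * (- x * (sgn j * 1ℤ * det m (minor j zero N))))
    ≡⟨ reorder x (sgn j) (det m (minor j zero N)) ⟩
  (x * x) * ((sgn j * sgn j) * det m (minor j zero N))
    ≡⟨ cong₂ (λ a b → a * (b * det m (minor j zero N))) M₀ⱼ²≡1 (sgn² j) ⟩
  1ℤ * (1ℤ * det m (minor j zero N))
    ≡⟨ trans (ℤP.*-identityˡ _) (ℤP.*-identityˡ (det m (minor j zero N))) ⟩
  det m (minor j zero N)
    ≡⟨ det-cong m entries ⟩
  det m (pivot M j) ∎
  where
  open ≡-Reasoning
  ĵ = suc j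
  x = M zero ĵ
  ι : Fin m → Fin (suc (suc m))
  ι = suc ∘ punchIn j

  -- Column operations clear row 0 outside column ĵ (M₁), then row ĵ outside column 0 (M₂).
  a₁ : Fin (suc (suc m)) → ℤ
  a₁ c with c Fin.≟ ĵ
  ... | yes _ = 0ℤ
  ... | no  _ = - (M zero c * x)
  a₁ĵ≡0 : a₁ ĵ ≡ 0ℤ
  a₁ĵ≡0 with ĵ Fin.≟ ĵ
  ... | yes _   = refl
  ... | no ĵ≢ĵ = ⊥-elim (ĵ≢ĵ refl)
  a₁-≢ : ∀ {c} → c ≢ ĵ → a₁ c ≡ - (M zero c * x)
  a₁-≢ {c} c≢ĵ with c Fin.≟ ĵ
  ... | yes c≡ĵ = ⊥-elim (c≢ĵ c≡ĵ)
  ... | no  _   = refl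

  M₁ : Matrix (suc (suc m))
  M₁ r c = M r c + a₁ c * M r ĵ
  a₂ : Fin (suc (suc m)) → ℤ
  a₂ zero    = 0ℤ
  a₂ (suc c) = - (M₁ ĵ (suc c) * M₁ ĵ zero)
  M₂ : Matrix (suc (suc m))
  M₂ r c = M₁ r c + a₂ c * M₁ r zero
  N : Matrix (suc m)
  N = minor zero ĵ M₂

  plus-zero : ∀ y {a} z → a ≡ 0ℤ → y + a * z ≡ y
  plus-zero y z refl = ℤP.+-identityʳ y
  cancel : ∀ y z → z * z ≡ 1ℤ → y + - (y * z) * z ≡ 0ℤ
  cancel y z z²≡1 = trans (ring y z) (trans (cong (λ w → y - y * w) z²≡1) (ring′ y))
    where ring : ∀ y z → y + - (y * z) * z ≡ y - y * (z * z)
          ring = solve-∀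
          ring′ : ∀ y → y - y * 1ℤ ≡ 0ℤ
          ring′ = solve-∀

  M₁ⱼ : ∀ c → M₁ ĵ c ≡ M ĵ c
  M₁ⱼ c = trans (cong (λ y → M ĵ c + a₁ c * y) Mⱼⱼ≡0) (trans (cong (M ĵ c +_) (ℤP.*-zeroʳ (a₁ c))) (ℤP.+-identityʳ (M ĵ c)))
  M₁-col₀ : ∀ r → M₁ r zero ≡ M r zero
  M₁-col₀ r = plus-zero (M r zero) (M r ĵ) (trans (a₁-≢ (λ ())) (cong (λ y → - (y * x)) M₀₀≡0))
  M₂₀ : ∀ c → M₂ zero c ≡ M₁ zero c
  M₂₀ c = trans (cong (λ y → M₁ zero c + a₂ c * y) (trans (M₁-col₀ zero) M₀₀≡0))
                (trans (cong (M₁ zero c +_) (ℤP.*-zeroʳ (a₂ c))) (ℤP.+-identityʳ (M₁ zero c)))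
  M₂₀ⱼ : M₂ zero ĵ ≡ x
  M₂₀ⱼ = trans (M₂₀ ĵ) (plus-zero x x a₁ĵ≡0)
  M₂₀≡0 : ∀ c → c ≢ ĵ → M₂ zero c ≡ 0ℤ
  M₂₀≡0 c c≢ĵ = trans (M₂₀ c) (trans (cong (λ a → M zero c + a * x) (a₁-≢ c≢ĵ)) (cancel (M zero c) x M₀ⱼ²≡1))
  Nⱼ₀ : N j zero ≡ M ĵ zero
  Nⱼ₀ = trans (ℤP.+-identityʳ (M₁ ĵ zero)) (M₁-col₀ ĵ)
  Nⱼ≡0 : ∀ c → c ≢ zero → N j c ≡ 0ℤ
  Nⱼ≡0 zero    c≢0 = ⊥-elim (c≢0 refl)
  Nⱼ≡0 (suc c) _   = trans (cong₂ (λ a b → a + - (a * b) * b) (M₁ⱼ (ι c)) (M₁-col₀ ĵ))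
    (cancel (M ĵ (ι c)) (M ĵ zero) (trans (cong (λ y → y * y) Mⱼ₀≡-M₀ⱼ) (trans (neg-square x) M₀ⱼ²≡1)))
    where neg-square : ∀ a → - a * - a ≡ a * a
          neg-square = solve-∀

  entries : ∀ r c → minor j zero N r c ≡ pivot M j r c
  entries r c = begin
    M₁ (ι r) (ι c) + - (M₁ ĵ (ι c) * M₁ ĵ zero) * M₁ (ι r) zero
      ≡⟨ cong₂ (λ a b → M₁ (ι r) (ι c) + - (a * b) * M₁ (ι r) zero) (M₁ⱼ (ι c)) (trans (M₁-col₀ ĵ) Mⱼ₀≡-M₀ⱼ) ⟩
    M₁ (ι r) (ι c) + - (M ĵ (ι c) * - x) * M₁ (ι r) zero
      ≡⟨ cong₂ (λ a b → M (ι r) (ι c) + a * M (ι r) ĵ + - (M ĵ (ι c) * - x) * b)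
           (a₁-≢ (FinP.punchInᵢ≢i j c ∘ FinP.suc-injective)) (M₁-col₀ (ι r)) ⟩
    M (ι r) (ι c) + - (M zero (ι c) * x) * M (ι r) ĵ + - (M ĵ (ι c) * - x) * M (ι r) zero
      ≡⟨ ring (M (ι r) (ι c)) (M zero (ι c)) x (M (ι r) ĵ) (M ĵ (ι c)) (M (ι r) zero) ⟩
    pivot M j r c ∎
    where ring : ∀ a b x d e f → a + - (b * x) * d + - (e * - x) * f ≡ a - x * (b * d - e * f)
          ring = solve-∀

  reorder : ∀ x s D → x * (1ℤ * - s * (- x * (s * 1ℤ * D))) ≡ (x * x) * ((s * s) * D)
  reorder = solve-∀

det-permuteRows : ∀ n (π : Permutation n n) →
  Σ ℤ λ s → s * s ≡ 1ℤ × (∀ M → det n (λ r c → M (π ⟨$⟩ʳ r) c) ≡ s * det n M)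
det-permuteRows zero    π = 1ℤ , refl , λ M → refl
det-permuteRows (suc n) π with det-permuteRows n (remove zero π)
... | s , s²≡1 , permuteᵣ = s * sgn t , square , permute
  where
  t = π ⟨$⟩ʳ zero
  square : s * sgn t * (s * sgn t) ≡ 1ℤ
  square = trans (ring s (sgn t)) (cong₂ _*_ s²≡1 (sgn² t))
    where ring : ∀ a b → a * b * (a * b) ≡ (a * a) * (b * b)
          ring = solve-∀
  permute : ∀ M → det (suc n) (λ r c → M (π ⟨$⟩ʳ r) c) ≡ s * sgn t * det (suc n) M
  permute M = begin
    sum (λ k → sgn k * (M t k * det n (minor zero k (λ r c → M (π ⟨$⟩ʳ r) c))))
      ≡⟨ sum-cong-≗ (λ k → cong (λ D → sgn k * (M t k * D))
           (trans (det-cong n λ r c → cong (λ i → M i (punchIn k c)) (Perm.punchIn-permute π zero r))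
                  (permuteᵣ (minor t k M)))) ⟩
    sum (λ k → sgn k * (M t k * (s * det n (minor t k M))))
      ≡⟨ sum-cong-≗ (λ k → factor (sgn t) (sgn k) (M t k) s (det n (minor t k M)) (sgn² t)) ⟩
    sum (λ k → s * sgn t * (M t k * cofactor t k M))
      ≡⟨ sym (*-distribˡ-sum (s * sgn t) (λ k → M t k * cofactor t k M)) ⟩
    s * sgn t * sum (λ k → M t k * cofactor t k M)
      ≡⟨ cong (s * sgn t *_) (sym (det-expandRow n t M)) ⟩
    s * sgn t * det (suc n) M ∎
    where
    open ≡-Reasoning
    regroup : ∀ p q y σ D → (p * p) * (q * (y * (σ * D))) ≡ σ * p * (y * (p * q * D))
    regroup = solve-∀
    factor : ∀ p q y σ D → p * p ≡ 1ℤ → q * (y * (σ * D)) ≡ σ * p * (y * (p * q * D))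
    factor p q y σ D p²≡1 = trans (sym (ℤP.*-identityˡ (q * (y * (σ * D)))))
                                  (trans (cong (_* (q * (y * (σ * D)))) (sym p²≡1)) (regroup p q y σ D))

det-permute : ∀ n (π : Permutation n n) (M : Matrix n) → det n (λ r c → M (π ⟨$⟩ʳ r) (π ⟨$⟩ʳ c)) ≡ det n M
det-permute n π M with det-permuteRows n π
... | s , s²≡1 , permuteRows = begin
  det n (λ r c → M (π ⟨$⟩ʳ r) (π ⟨$⟩ʳ c))
    ≡⟨ permuteRows (λ r c → M r (π ⟨$⟩ʳ c)) ⟩
  s * det n (λ r c → M r (π ⟨$⟩ʳ c))
    ≡⟨ cong (s *_) (trans (sym (det-transpose n (λ r c → M r (π ⟨$⟩ʳ c)))) (permuteRows (transpose M))) ⟩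
  s * (s * det n (transpose M))
    ≡⟨ cong (λ D → s * (s * D)) (det-transpose n M) ⟩
  s * (s * det n M)
    ≡⟨ sym (ℤP.*-assoc s s (det n M)) ⟩
  s * s * det n M
    ≡⟨ cong (_* det n M) s²≡1 ⟩
  1ℤ * det n M
    ≡⟨ ℤP.*-identityˡ (det n M) ⟩
  det n M ∎
  where open ≡-Reasoning

-- Reduction modulo 2

odd : ℕ → Bool
odd zero    = false
odd (suc n) = not (odd n)

odd-+ : ∀ m n → odd (m ℕ.+ n) ≡ odd m xor odd n
odd-+ zero    n = refl
odd-+ (suc m) n = trans (cong not (odd-+ m n)) (not-distribˡ-xor (odd m) (odd n))

odd-* : ∀ m n → odd (m ℕ.* n) ≡ odd m ∧ odd n
odd-* zero    n = refl
odd-* (suc m) n = begin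
  odd (n ℕ.+ m ℕ.* n)                  ≡⟨ odd-+ n (m ℕ.* n) ⟩
  odd n xor odd (m ℕ.* n)              ≡⟨ cong (odd n xor_) (odd-* m n) ⟩
  (true ∧ odd n) xor (odd m ∧ odd n)   ≡⟨ sym (∧-distribʳ-xor (odd n) true (odd m)) ⟩
  (true xor odd m) ∧ odd n             ≡⟨ cong (_∧ odd n) (true-xor (odd m)) ⟩
  not (odd m) ∧ odd n                  ∎
  where open ≡-Reasoning

parity : ℤ → Bool
parity z = odd ∣ z ∣

parity-neg : ∀ a → parity (- a) ≡ parity a
parity-neg (ℤ.+ zero)    = refl
parity-neg ℤ.+[1+ n ]    = refl
parity-neg ℤ.-[1+ n ]    = refl

parity-* : ∀ a b → parity (a * b) ≡ parity a ∧ parity b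
parity-* a b = trans (cong odd (ℤP.abs-* a b)) (odd-* ∣ a ∣ ∣ b ∣)

parity-suc : ∀ a → parity (1ℤ + a) ≡ not (parity a)
parity-suc (ℤ.+ n)            = refl
parity-suc ℤ.-[1+ zero ]      = refl
parity-suc ℤ.-[1+ suc n ]     = sym (not-involutive _)

parity-pred : ∀ a → parity (-1ℤ + a) ≡ not (parity a)
parity-pred (ℤ.+ zero)        = refl
parity-pred ℤ.+[1+ n ]        = sym (not-involutive _)
parity-pred ℤ.-[1+ n ]        = refl

private
  exchange : ∀ a b c → a + (b + c) ≡ b + (a + c)
  exchange a b c = trans (sym (ℤP.+-assoc a b c)) (trans (cong (_+ c) (ℤP.+-comm a b)) (ℤP.+-assoc b a c))

parity-+ : ∀ a b → parity (a + b) ≡ parity a xor parity b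
parity-+ a (ℤ.+ zero) = trans (cong parity (ℤP.+-identityʳ a)) (sym (xor-identityʳ (parity a)))
parity-+ a ℤ.+[1+ n ] = begin
  parity (a + (1ℤ + ℤ.+ n))    ≡⟨ cong parity (exchange a 1ℤ (ℤ.+ n)) ⟩
  parity (1ℤ + (a + ℤ.+ n))    ≡⟨ parity-suc (a + ℤ.+ n) ⟩
  not (parity (a + ℤ.+ n))     ≡⟨ cong not (parity-+ a (ℤ.+ n)) ⟩
  not (parity a xor odd n)     ≡⟨ not-distribʳ-xor (parity a) (odd n) ⟩
  parity a xor odd (suc n)     ∎
  where open ≡-Reasoning
parity-+ a ℤ.-[1+ zero ] = begin
  parity (a + -1ℤ)             ≡⟨ cong parity (ℤP.+-comm a -1ℤ) ⟩
  parity (-1ℤ + a)             ≡⟨ parity-pred a ⟩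
  not (parity a)               ≡⟨ cong not (xor-identityʳ (parity a)) ⟨
  not (parity a xor false)     ≡⟨ not-distribʳ-xor (parity a) false ⟩
  parity a xor true            ∎
  where open ≡-Reasoning
parity-+ a ℤ.-[1+ suc n ] = begin
  parity (a + (-1ℤ + ℤ.-[1+ n ]))   ≡⟨ cong parity (exchange a -1ℤ ℤ.-[1+ n ]) ⟩
  parity (-1ℤ + (a + ℤ.-[1+ n ]))   ≡⟨ parity-pred (a + ℤ.-[1+ n ]) ⟩
  not (parity (a + ℤ.-[1+ n ]))     ≡⟨ cong not (parity-+ a ℤ.-[1+ n ]) ⟩
  not (parity a xor odd (suc n))    ≡⟨ not-distribʳ-xor (parity a) (odd (suc n)) ⟩
  parity a xor odd (suc (suc n))    ∎
  where open ≡-Reasoning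

module 𝔽₂ = Det 𝔽₂-rawRing

det𝔽₂-cong : ∀ n {M N : Fin n → Fin n → Bool} → (∀ r c → M r c ≡ N r c) → det𝔽₂ n M ≡ det𝔽₂ n N
det𝔽₂-cong zero    M≗N = refl
det𝔽₂-cong (suc n) M≗N = sumFin-cong λ j →
  cong₂ (λ a d → 𝔽₂.sgn j ∧ (a ∧ d)) (M≗N zero j) (det𝔽₂-cong n λ r c → M≗N (suc r) (punchIn j c))
  where
  sumFin-cong : ∀ {m} {f g : Fin m → Bool} → (∀ j → f j ≡ g j) → 𝔽₂.sumFin f ≡ 𝔽₂.sumFin g
  sumFin-cong {zero}  f≗g = refl
  sumFin-cong {suc m} f≗g = cong₂ _xor_ (f≗g zero) (sumFin-cong (f≗g ∘ suc))

parity-det : ∀ n (M : Matrix n) → parity (det n M) ≡ det𝔽₂ n (λ r c → parity (M r c))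
parity-det zero    M = refl
parity-det (suc n) M = parity-sum (λ j → sgn j * (M zero j * det n (minor zero j M))) λ j → begin
  parity (sgn j * (M zero j * det n (minor zero j M)))
    ≡⟨ trans (parity-* (sgn j) (M zero j * det n (minor zero j M)))
             (cong₂ _∧_ (parity-sgn j) (parity-* (M zero j) (det n (minor zero j M)))) ⟩
  true ∧ (parity (M zero j) ∧ parity (det n (minor zero j M)))
    ≡⟨ cong₂ (λ s d → s ∧ (parity (M zero j) ∧ d)) (sym (𝔽₂-sgn j)) (parity-det n (minor zero j M)) ⟩
  𝔽₂.sgn j ∧ (parity (M zero j) ∧ det𝔽₂ n (λ r c → parity (M (suc r) (punchIn j c)))) ∎
  where
  open ≡-Reasoning
  parity-sgn : ∀ {m} (j : Fin m) → parity (sgn j) ≡ true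
  parity-sgn zero    = refl
  parity-sgn (suc j) = trans (parity-neg (sgn j)) (parity-sgn j)
  𝔽₂-sgn : ∀ {m} (j : Fin m) → 𝔽₂.sgn j ≡ true
  𝔽₂-sgn zero    = refl
  𝔽₂-sgn (suc j) = 𝔽₂-sgn j
  parity-sum : ∀ {m} (f : Fin m → ℤ) {g : Fin m → Bool} → (∀ j → parity (f j) ≡ g j) → parity (sum f) ≡ 𝔽₂.sumFin g
  parity-sum {zero}  f f≗g = refl
  parity-sum {suc m} f f≗g =
    trans (parity-+ (f zero) (sum (f ∘ suc))) (cong₂ _xor_ (f≗g zero) (parity-sum (f ∘ suc) (f≗g ∘ suc)))

bit : Bool → ℤ
bit b = if b then 1ℤ else 0ℤ

det𝔽₂≡parity-det : ∀ n (N : Fin n → Fin n → Bool) → det𝔽₂ n N ≡ parity (det n (λ r c → bit (N r c)))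
det𝔽₂≡parity-det n N = sym (trans (parity-det n (λ r c → bit (N r c))) (det𝔽₂-cong n λ r c → parity-bit (N r c)))
  where
  parity-bit : ∀ b → parity (bit b) ≡ b
  parity-bit true  = refl
  parity-bit false = refl

det𝔽₂-permute : ∀ n (π : Permutation n n) (N : Fin n → Fin n → Bool) →
  det𝔽₂ n (λ r c → N (π ⟨$⟩ʳ r) (π ⟨$⟩ʳ c)) ≡ det𝔽₂ n N
det𝔽₂-permute n π N = begin
  det𝔽₂ n (λ r c → N (π ⟨$⟩ʳ r) (π ⟨$⟩ʳ c))             ≡⟨ det𝔽₂≡parity-det n _ ⟩
  parity (det n (λ r c → bit (N (π ⟨$⟩ʳ r) (π ⟨$⟩ʳ c))))  ≡⟨ cong parity (det-permute n π (λ r c → bit (N r c))) ⟩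
  parity (det n (λ r c → bit (N r c)))                   ≡⟨ det𝔽₂≡parity-det n N ⟨
  det𝔽₂ n N                                              ∎
  where open ≡-Reasoning

-- Principal minors

size : ∀ {n} → Vec Bool n → ℕ
size U = length (elems U)

falses : ∀ {n} → Vec Bool n → ℕ
falses []          = 0
falses (true ∷ U)  = falses U
falses (false ∷ U) = suc (falses U)

lookup-map : ∀ {A B : Set} (f : A → B) (xs : List A) (a : Fin (length (List.map f xs))) →
  lookup (List.map f xs) a ≡ f (lookup xs (cast (ListP.length-map f xs) a))
lookup-map f (x ∷ xs) zero    = refl
lookup-map f (x ∷ xs) (suc a) = lookup-map f xs a

size+falses : ∀ {n} (U : Vec Bool n) → size U ℕ.+ falses U ≡ n
size+falses []          = refl
size+falses (true ∷ U)  = cong suc (trans (cong (ℕ._+ falses U) (ListP.length-map suc (elems U))) (size+falses U))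
size+falses (false ∷ U) = trans (cong (ℕ._+ suc (falses U)) (ListP.length-map suc (elems U)))
                                (trans (ℕP.+-suc (size U) (falses U)) (cong suc (size+falses U)))

falses≡∸size : ∀ {n} (U : Vec Bool n) → falses U ≡ n ∸ size U
falses≡∸size {n} U = trans (sym (ℕP.m+n∸m≡n (size U) (falses U))) (cong (_∸ size U) (size+falses U))

size≤ : ∀ {n} (U : Vec Bool n) → size U ≤ n
size≤ U = subst (size U ≤_) (size+falses U) (ℕP.m≤m+n (size U) (falses U))

private
  map-suc-punchIn : ∀ {n} (i : Fin (suc n)) xs → List.map suc (List.map (punchIn i) xs) ≡ List.map (punchIn (suc i)) (List.map suc xs)
  map-suc-punchIn i xs = trans (sym (ListP.map-∘ xs)) (ListP.map-∘ xs)

elems-removeAt : ∀ {n} (U : Vec Bool (suc n)) i → Vec.lookup U i ≡ false →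
  elems U ≡ List.map (punchIn i) (elems (Vec.removeAt U i))
elems-removeAt (false ∷ U)     zero    _  = refl
elems-removeAt (true ∷ y ∷ U)  (suc i) Uᵢ = cong (zero ∷_) (trans (cong (List.map suc) (elems-removeAt (y ∷ U) i Uᵢ))
  (map-suc-punchIn i (elems (Vec.removeAt (y ∷ U) i))))
elems-removeAt (false ∷ y ∷ U) (suc i) Uᵢ = trans (cong (List.map suc) (elems-removeAt (y ∷ U) i Uᵢ))
  (map-suc-punchIn i (elems (Vec.removeAt (y ∷ U) i)))

falses-removeAt : ∀ {n} (U : Vec Bool (suc n)) i → Vec.lookup U i ≡ false → falses U ≡ suc (falses (Vec.removeAt U i))
falses-removeAt (false ∷ U)     zero    _  = refl
falses-removeAt (true ∷ y ∷ U)  (suc i) Uᵢ = falses-removeAt (y ∷ U) i Uᵢ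
falses-removeAt (false ∷ y ∷ U) (suc i) Uᵢ = cong suc (falses-removeAt (y ∷ U) i Uᵢ)

lookup-removeAt : ∀ {A : Set} {n} (U : Vec A (suc n)) i r → Vec.lookup (Vec.removeAt U i) r ≡ Vec.lookup U (punchIn i r)
lookup-removeAt U i r = trans (cong (Vec.lookup (Vec.removeAt U i)) (sym (FinP.punchOut-punchIn i)))
                              (VecP.removeAt-punchOut U (FinP.punchInᵢ≢i i r ∘ sym))

elems-full : ∀ {n} (U : Vec Bool n) → (∀ i → Vec.lookup U i ≡ true) → elems U ≡ List.allFin n
elems-full []         _      = refl
elems-full (true ∷ U) U≡true = cong (zero ∷_) (trans (cong (List.map suc) (elems-full U (U≡true ∘ suc)))
                                                     (ListP.map-tabulate id suc))
elems-full (false ∷ U) U≡true with U≡true zero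
... | ()

falses-full : ∀ {n} (U : Vec Bool n) → (∀ i → Vec.lookup U i ≡ true) → falses U ≡ 0
falses-full []          _      = refl
falses-full (true ∷ U)  U≡true = falses-full U (U≡true ∘ suc)
falses-full (false ∷ U) U≡true with U≡true zero
... | ()

principalMinor : ∀ {n} → Matrix n → List (Fin n) → ℤ
principalMinor B xs = det (length xs) (λ a b → B (lookup xs a) (lookup xs b))

det-cast : ∀ {m n} (m≡n : m ≡ n) (M : Matrix m) (N : Matrix n) →
  (∀ a b → M a b ≡ N (cast m≡n a) (cast m≡n b)) → det m M ≡ det n N
det-cast {m} refl M N M≗N = det-cong m λ a b → trans (M≗N a b) (cong₂ N (FinP.cast-is-id refl a) (FinP.cast-is-id refl b))

principalMinor-map : ∀ {m n} (B : Matrix n) (f : Fin m → Fin n) xs →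
  principalMinor B (List.map f xs) ≡ principalMinor (λ r c → B (f r) (f c)) xs
principalMinor-map B f xs = det-cast (ListP.length-map f xs) _ _ λ a b → cong₂ B (lookup-map f xs a) (lookup-map f xs b)

principalMinor-allFin : ∀ n (B : Matrix n) → principalMinor B (List.allFin n) ≡ det n B
principalMinor-allFin n B = det-cast (ListP.length-tabulate id) _ B λ a b →
  cong₂ B (lookup-tabulate a) (lookup-tabulate b)
  where
  lookup-tabulate : ∀ a → lookup (List.allFin n) a ≡ cast (ListP.length-tabulate id) a
  lookup-tabulate a = trans (cong (lookup (List.allFin n)) (sym (FinP.cast-involutive (sym eq) eq a)))
                            (ListP.lookup-tabulate id (cast eq a))
    where eq = ListP.length-tabulate {n = n} id

scalarMatrix-punchIn : ∀ {n} u (i : Fin (suc n)) r c → scalarMatrix (suc n) u (punchIn i r) (punchIn i c) ≡ scalarMatrix n u r c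
scalarMatrix-punchIn u i r c with r Fin.≟ c
... | yes refl = scalarMatrix-diag u (punchIn i r)
... | no r≢c   = scalarMatrix-offDiag u (r≢c ∘ FinP.punchIn-injective i r c)

det-mix-scalar : ∀ n (u : ℤ) (U : Vec Bool n) (B : Matrix n) →
  det n (mix U (scalarMatrix n u) B) ≡ u ^ falses U * principalMinor B (elems U)
det-mix-scalar n u U B with FinP.any? (λ i → Vec.lookup U i BoolP.≟ false)
det-mix-scalar (suc n) u U B | yes (i , Uᵢ≡false) = begin
  det (suc n) M
    ≡⟨ det-unitRow n i i u M (trans (rowᵢ i) (scalarMatrix-diag u i))
                   (λ c c≢i → trans (rowᵢ c) (scalarMatrix-offDiag u (c≢i ∘ sym))) ⟩
  u * (sgn i * sgn i * det n (minor i i M))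
    ≡⟨ cong (λ D → u * (sgn i * sgn i * D)) (trans (det-cong n minor≗) (det-mix-scalar n u U′ B′)) ⟩
  u * (sgn i * sgn i * (u ^ falses U′ * principalMinor B′ (elems U′)))
    ≡⟨ cong (λ s → u * (s * (u ^ falses U′ * principalMinor B′ (elems U′)))) (sgn² i) ⟩
  u * (1ℤ * (u ^ falses U′ * principalMinor B′ (elems U′)))
    ≡⟨ cong (u *_) (ℤP.*-identityˡ (u ^ falses U′ * principalMinor B′ (elems U′))) ⟩
  u * (u ^ falses U′ * principalMinor B′ (elems U′))
    ≡⟨ ℤP.*-assoc u (u ^ falses U′) (principalMinor B′ (elems U′)) ⟨
  u ^ suc (falses U′) * principalMinor B′ (elems U′)
    ≡⟨ cong₂ (λ k p → u ^ k * p) (sym (falses-removeAt U i Uᵢ≡false))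
         (sym (trans (cong (principalMinor B) (elems-removeAt U i Uᵢ≡false)) (principalMinor-map B (punchIn i) (elems U′)))) ⟩
  u ^ falses U * principalMinor B (elems U) ∎
  where
  open ≡-Reasoning
  M = mix U (scalarMatrix (suc n) u) B
  U′ = Vec.removeAt U i
  B′ = minor i i B
  rowᵢ : ∀ c → M i c ≡ scalarMatrix (suc n) u i c
  rowᵢ c = cong (λ b → if b then B i c else scalarMatrix (suc n) u i c) Uᵢ≡false
  minor≗ : ∀ r c → minor i i M r c ≡ mix U′ (scalarMatrix n u) B′ r c
  minor≗ r c = trans (cong (λ b → if b then B′ r c else scalarMatrix (suc n) u (punchIn i r) (punchIn i c)) (sym (lookup-removeAt U i r)))
                     (cong (λ x → if Vec.lookup U′ r then B′ r c else x) (scalarMatrix-punchIn u i r c))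
det-mix-scalar n u U B | no ¬∃false = begin
  det n (mix U (scalarMatrix n u) B)
                                           ≡⟨ det-cong n (λ r c → cong (λ b → if b then B r c else scalarMatrix n u r c) (U≡true r)) ⟩
  det n B                                  ≡⟨ trans (cong (principalMinor B) (elems-full U U≡true)) (principalMinor-allFin n B) ⟨
  principalMinor B (elems U)               ≡⟨ ℤP.*-identityˡ (principalMinor B (elems U)) ⟨
  1ℤ * principalMinor B (elems U)          ≡⟨ cong (λ k → u ^ k * principalMinor B (elems U)) (falses-full U U≡true) ⟨
  u ^ falses U * principalMinor B (elems U) ∎
  where
  open ≡-Reasoning
  U≡true : ∀ i → Vec.lookup U i ≡ true
  U≡true i with Vec.lookup U i in Uᵢ
  ... | true  = refl
  ... | false = ⊥-elim (¬∃false (i , Uᵢ))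

det-scalar+-expand : ∀ n (u : ℤ) (B : Matrix n) →
  det n (λ r c → scalarMatrix n u r c + B r c) ≡ sumList (λ U → u ^ (n ∸ size U) * principalMinor B (elems U)) (subsets n)
det-scalar+-expand n u B = trans (det-mix n (scalarMatrix n u) B) (sumList-cong (subsets n) λ U →
  trans (det-mix-scalar n u U B) (cong (λ k → u ^ k * principalMinor B (elems U)) (falses≡∸size U)))

private
  cast-injective : ∀ {m n} .(m≡n : m ≡ n) {x y : Fin m} → cast m≡n x ≡ cast m≡n y → x ≡ y
  cast-injective m≡n {x} {y} eq =
    trans (sym (FinP.cast-involutive (sym m≡n) m≡n x)) (trans (cong (cast (sym m≡n)) eq) (FinP.cast-involutive (sym m≡n) m≡n y))

elems-injective : ∀ {n} (U : Vec Bool n) {a b : Fin (size U)} → lookup (elems U) a ≡ lookup (elems U) b → a ≡ b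
elems-injective (true ∷ U) {zero}  {zero}  _  = refl
elems-injective (true ∷ U) {zero}  {suc b} eq with trans eq (lookup-map suc (elems U) b)
... | ()
elems-injective (true ∷ U) {suc a} {zero}  eq with trans (sym (lookup-map suc (elems U) a)) eq
... | ()
elems-injective (true ∷ U) {suc a} {suc b} eq = cong suc (cast-injective (ListP.length-map suc (elems U))
  (elems-injective U (FinP.suc-injective (trans (sym (lookup-map suc (elems U) a)) (trans eq (lookup-map suc (elems U) b))))))
elems-injective (false ∷ U) {a} {b} eq = cast-injective (ListP.length-map suc (elems U))
  (elems-injective U (FinP.suc-injective (trans (sym (lookup-map suc (elems U) a)) (trans eq (lookup-map suc (elems U) b)))))

elems-sound : ∀ {n} (U : Vec Bool n) (a : Fin (size U)) → Vec.lookup U (lookup (elems U) a) ≡ true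
elems-sound (true ∷ U)  zero    = refl
elems-sound (true ∷ U)  (suc a) = trans (cong (Vec.lookup (true ∷ U)) (lookup-map suc (elems U) a)) (elems-sound U _)
elems-sound (false ∷ U) a       = trans (cong (Vec.lookup (false ∷ U)) (lookup-map suc (elems U) a)) (elems-sound U _)

private
  lookup-map-suc : ∀ {n} (xs : List (Fin n)) a {v} → lookup xs a ≡ v →
    lookup (List.map suc xs) (cast (sym (ListP.length-map suc xs)) a) ≡ suc v
  lookup-map-suc xs a eq = trans (lookup-map suc xs _)
    (cong suc (trans (cong (lookup xs) (FinP.cast-involutive (ListP.length-map suc xs) (sym (ListP.length-map suc xs)) a)) eq))

elems-complete : ∀ {n} (U : Vec Bool n) v → Vec.lookup U v ≡ true → Σ (Fin (size U)) λ a → lookup (elems U) a ≡ v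
elems-complete (true ∷ U)  zero    _  = zero , refl
elems-complete (true ∷ U)  (suc v) Uᵥ with elems-complete U v Uᵥ
... | a , eₐ≡v = suc (cast (sym (ListP.length-map suc (elems U))) a) , lookup-map-suc (elems U) a eₐ≡v
elems-complete (false ∷ U) (suc v) Uᵥ with elems-complete U v Uᵥ
... | a , eₐ≡v = cast (sym (ListP.length-map suc (elems U))) a , lookup-map-suc (elems U) a eₐ≡v

-- The polynomial Q_G as a sum over vertex sets

sumList-applyUpTo : ∀ (g : ℕ → ℤ) m (f : ℕ → ℕ) → sumList g (List.applyUpTo f m) ≡ sum (λ (k : Fin m) → g (f (toℕ k)))
sumList-applyUpTo g zero    f = refl
sumList-applyUpTo g (suc m) f = cong (g (f 0) +_) (sumList-applyUpTo g m (f ∘ suc))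

sumList-upTo-single : ∀ m l (x : ℤ) → l ℕ.< m → sumList (λ k → if ⌊ l ℕ.≟ k ⌋ then x else 0ℤ) (List.upTo m) ≡ x
sumList-upTo-single m l x l<m = begin
  sumList δ (List.upTo m)       ≡⟨ sumList-applyUpTo δ m id ⟩
  sum {m} (δ ∘ toℕ)             ≡⟨ sum-single (Fin.fromℕ< l<m) (δ ∘ toℕ) off ⟩
  δ (toℕ (Fin.fromℕ< l<m))      ≡⟨ cong δ (FinP.toℕ-fromℕ< l<m) ⟩
  δ l                           ≡⟨ on ⟩
  x                             ∎
  where
  open ≡-Reasoning
  δ : ℕ → ℤ
  δ k = if ⌊ l ℕ.≟ k ⌋ then x else 0ℤ
  off : ∀ k → k ≢ Fin.fromℕ< l<m → δ (toℕ k) ≡ 0ℤ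
  off k k≢l with l ℕ.≟ toℕ k
  ... | yes l≡k = ⊥-elim (k≢l (FinP.toℕ-injective (trans (sym l≡k) (sym (FinP.toℕ-fromℕ< l<m)))))
  ... | no _    = refl
  on : δ l ≡ x
  on with l ℕ.≟ l
  ... | yes _   = refl
  ... | no l≢l = ⊥-elim (l≢l refl)

QGraph-subsetSum : ∀ {n} (G : SimpleGraph n) u →
  QGraph G u ≡ sumList (λ U → u ^ (n ∸ size U) * ℤ.+ νInduced G U) (subsets n)
QGraph-subsetSum {n} G u = begin
  QGraph G u                                                     ≡⟨⟩
  sumList (λ k → coeff k (subsets n)) (List.upTo (suc n))         ≡⟨ regroup (subsets n) ⟩
  sumList (λ U → u ^ (n ∸ size U) * ℤ.+ ν U) (subsets n)          ∎
  where
  open ≡-Reasoning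
  ν = νInduced G
  size≟ : ∀ k (U : Vec Bool n) → Dec (size U ≡ k)
  size≟ k U = size U ℕ.≟ k
  coeff : ℕ → List (Vec Bool n) → ℤ
  coeff k Us = ℤ.+ sumℕ (List.map ν (filter (size≟ k) Us)) * u ^ (n ∸ k)
  δ : Vec Bool n → ℕ → ℤ
  δ U k = if ⌊ size U ℕ.≟ k ⌋ then ℤ.+ ν U * u ^ (n ∸ k) else 0ℤ
  coeff-∷ : ∀ k U Us → coeff k (U ∷ Us) ≡ δ U k + coeff k Us
  coeff-∷ k U Us with size U ℕ.≟ k
  ... | yes s≡k = begin
    ℤ.+ sumℕ (List.map ν (filter (size≟ k) (U ∷ Us))) * u ^ (n ∸ k)
      ≡⟨ cong (λ Vs → ℤ.+ sumℕ (List.map ν Vs) * u ^ (n ∸ k)) (ListP.filter-accept (size≟ k) {x = U} {xs = Us} s≡k) ⟩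
    ℤ.+ (ν U ℕ.+ sumℕ (List.map ν (filter (size≟ k) Us))) * u ^ (n ∸ k)
      ≡⟨ cong (_* u ^ (n ∸ k)) (ℤP.pos-+ (ν U) (sumℕ (List.map ν (filter (size≟ k) Us)))) ⟩
    (ℤ.+ ν U + ℤ.+ sumℕ (List.map ν (filter (size≟ k) Us))) * u ^ (n ∸ k)
      ≡⟨ ℤP.*-distribʳ-+ (u ^ (n ∸ k)) (ℤ.+ ν U) (ℤ.+ sumℕ (List.map ν (filter (size≟ k) Us))) ⟩
    ℤ.+ ν U * u ^ (n ∸ k) + coeff k Us ∎
  ... | no s≢k = trans
    (cong (λ Vs → ℤ.+ sumℕ (List.map ν Vs) * u ^ (n ∸ k)) (ListP.filter-reject (size≟ k) {x = U} {xs = Us} s≢k))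
    (sym (ℤP.+-identityˡ (coeff k Us)))
  δ-exponent : ∀ U k → δ U k ≡ (if ⌊ size U ℕ.≟ k ⌋ then ℤ.+ ν U * u ^ (n ∸ size U) else 0ℤ)
  δ-exponent U k with size U ℕ.≟ k
  ... | yes refl = refl
  ... | no  _    = refl
  δ-sum : ∀ U → sumList (δ U) (List.upTo (suc n)) ≡ u ^ (n ∸ size U) * ℤ.+ ν U
  δ-sum U = begin
    sumList (δ U) (List.upTo (suc n))
      ≡⟨ sumList-cong (List.upTo (suc n)) (δ-exponent U) ⟩
    sumList (λ k → if ⌊ size U ℕ.≟ k ⌋ then ℤ.+ ν U * u ^ (n ∸ size U) else 0ℤ) (List.upTo (suc n))
      ≡⟨ sumList-upTo-single (suc n) (size U) (ℤ.+ ν U * u ^ (n ∸ size U)) (s≤s (size≤ U)) ⟩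
    ℤ.+ ν U * u ^ (n ∸ size U)
      ≡⟨ ℤP.*-comm (ℤ.+ ν U) (u ^ (n ∸ size U)) ⟩
    u ^ (n ∸ size U) * ℤ.+ ν U ∎
  regroup : ∀ Us → sumList (λ k → coeff k Us) (List.upTo (suc n)) ≡ sumList (λ U → u ^ (n ∸ size U) * ℤ.+ ν U) Us
  regroup []       = sumList-zero (List.upTo (suc n)) (λ k → refl)
  regroup (U ∷ Us) = begin
    sumList (λ k → coeff k (U ∷ Us)) (List.upTo (suc n))
      ≡⟨ sumList-cong (List.upTo (suc n)) (λ k → coeff-∷ k U Us) ⟩
    sumList (λ k → δ U k + coeff k Us) (List.upTo (suc n))
      ≡⟨ sumList-+ (δ U) (λ k → coeff k Us) (List.upTo (suc n)) ⟩
    sumList (δ U) (List.upTo (suc n)) + sumList (λ k → coeff k Us) (List.upTo (suc n))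
      ≡⟨ cong₂ _+_ (δ-sum U) (regroup Us) ⟩
    u ^ (n ∸ size U) * ℤ.+ ν U + sumList (λ U → u ^ (n ∸ size U) * ℤ.+ ν U) Us ∎

permuteSubset : ∀ {n} → Permutation n n → Vec Bool n → Vec Bool n
permuteSubset π U = Vec.tabulate λ i → Vec.lookup U (π ⟨$⟩ʳ i)

sumList-subsets-insertAt : ∀ n (t : Fin (suc n)) (f : Vec Bool (suc n) → ℤ) →
  sumList f (subsets (suc n)) ≡ sumList (λ V → f (insertAt V t true)) (subsets n) + sumList (λ V → f (insertAt V t false)) (subsets n)
sumList-subsets-insertAt n       zero    f = sumList-subsets-suc f
sumList-subsets-insertAt (suc n) (suc t) f = begin
  sumList f (subsets (suc (suc n)))
    ≡⟨ sumList-subsets-suc f ⟩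
  sumList (f ∘ (true ∷_)) (subsets (suc n)) + sumList (f ∘ (false ∷_)) (subsets (suc n))
    ≡⟨ cong₂ _+_ (sumList-subsets-insertAt n t (f ∘ (true ∷_))) (sumList-subsets-insertAt n t (f ∘ (false ∷_))) ⟩
  (S true true + S true false) + (S false true + S false false)
    ≡⟨ swap (S true true) (S true false) (S false true) (S false false) ⟩
  (S true true + S false true) + (S true false + S false false)
    ≡⟨ cong₂ _+_ (sumList-subsets-suc (λ V → f (insertAt V (suc t) true)))
                 (sumList-subsets-suc (λ V → f (insertAt V (suc t) false))) ⟨
  sumList (λ V → f (insertAt V (suc t) true)) (subsets (suc n)) + sumList (λ V → f (insertAt V (suc t) false)) (subsets (suc n)) ∎
  where
  open ≡-Reasoning
  S : Bool → Bool → ℤ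
  S b b′ = sumList (λ V → f (b ∷ insertAt V t b′)) (subsets n)
  swap : ∀ a b c d → a + b + (c + d) ≡ a + c + (b + d)
  swap = solve-∀

sumList-subsets-permute : ∀ n (π : Permutation n n) (f : Vec Bool n → ℤ) →
  sumList (f ∘ permuteSubset π) (subsets n) ≡ sumList f (subsets n)
sumList-subsets-permute zero    π f = refl
sumList-subsets-permute (suc n) π f = begin
  sumList (f ∘ permuteSubset π) (subsets (suc n))
    ≡⟨ sumList-subsets-insertAt n t (f ∘ permuteSubset π) ⟩
  sumList (λ V → f (permuteSubset π (insertAt V t true))) (subsets n)
    + sumList (λ V → f (permuteSubset π (insertAt V t false))) (subsets n)
    ≡⟨ cong₂ _+_ (sumList-cong (subsets n) (cong f ∘ permuteSubset-insertAt true))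
                 (sumList-cong (subsets n) (cong f ∘ permuteSubset-insertAt false)) ⟩
  sumList (f ∘ (true ∷_) ∘ permuteSubset ρ) (subsets n) + sumList (f ∘ (false ∷_) ∘ permuteSubset ρ) (subsets n)
    ≡⟨ cong₂ _+_ (sumList-subsets-permute n ρ (f ∘ (true ∷_))) (sumList-subsets-permute n ρ (f ∘ (false ∷_))) ⟩
  sumList (f ∘ (true ∷_)) (subsets n) + sumList (f ∘ (false ∷_)) (subsets n)
    ≡⟨ sumList-subsets-suc f ⟨
  sumList f (subsets (suc n)) ∎
  where
  open ≡-Reasoning
  t = π ⟨$⟩ʳ zero
  ρ = remove zero π
  permuteSubset-insertAt : ∀ b V → permuteSubset π (insertAt V t b) ≡ b ∷ permuteSubset ρ V
  permuteSubset-insertAt b V = cong₂ _∷_ (VecP.insertAt-lookup V t b) (VecP.tabulate-cong λ r →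
    trans (cong (Vec.lookup (insertAt V t b)) (Perm.punchIn-permute π zero r)) (VecP.insertAt-punchIn V t b (ρ ⟨$⟩ʳ r)))

module _ {n} (σ : Permutation n n) (U : Vec Bool n) where

  private
    W = permuteSubset σ U

    lookup-W : ∀ v → Vec.lookup W v ≡ Vec.lookup U (σ ⟨$⟩ʳ v)
    lookup-W v = VecP.lookup∘tabulate (λ i → Vec.lookup U (σ ⟨$⟩ʳ i)) v

    to : Fin (size W) → Fin (size U)
    to a = proj₁ (elems-complete U _ (trans (sym (lookup-W _)) (elems-sound W a)))
    to-spec : ∀ a → lookup (elems U) (to a) ≡ σ ⟨$⟩ʳ lookup (elems W) a
    to-spec a = proj₂ (elems-complete U _ (trans (sym (lookup-W _)) (elems-sound W a)))

    from : Fin (size U) → Fin (size W)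
    from b = proj₁ (elems-complete W (σ ⟨$⟩ˡ lookup (elems U) b)
      (trans (lookup-W _) (trans (cong (Vec.lookup U) (Perm.inverseʳ σ)) (elems-sound U b))))
    from-spec : ∀ b → lookup (elems W) (from b) ≡ σ ⟨$⟩ˡ lookup (elems U) b
    from-spec b = proj₂ (elems-complete W (σ ⟨$⟩ˡ lookup (elems U) b)
      (trans (lookup-W _) (trans (cong (Vec.lookup U) (Perm.inverseʳ σ)) (elems-sound U b))))

    positions : Permutation (size W) (size U)
    positions = Perm.permutation to from
      (λ b → elems-injective U (trans (to-spec (from b)) (trans (cong (σ ⟨$⟩ʳ_) (from-spec b)) (Perm.inverseʳ σ))))
      (λ a → elems-injective W (trans (from-spec (to a)) (trans (cong (σ ⟨$⟩ˡ_) (to-spec a)) (Perm.inverseˡ σ))))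

    det𝔽₂-reindex : ∀ {k l} → k ≡ l → (π : Permutation k l) (N : Fin l → Fin l → Bool) →
      det𝔽₂ k (λ a b → N (π ⟨$⟩ʳ a) (π ⟨$⟩ʳ b)) ≡ det𝔽₂ l N
    det𝔽₂-reindex refl = det𝔽₂-permute _

  size-permuteSubset : size (permuteSubset σ U) ≡ size U
  size-permuteSubset = Perm.↔⇒≡ positions

  νInduced-permuteSubset : (G H : SimpleGraph n) → (∀ i j → adj H (σ ⟨$⟩ʳ i) (σ ⟨$⟩ʳ j) ≡ adj G i j) →
                           νInduced G (permuteSubset σ U) ≡ νInduced H U
  νInduced-permuteSubset G H adj-σ = cong (λ b → if b then 1 else 0) (trans
    (det𝔽₂-cong (size W) λ a b → trans (sym (adj-σ _ _)) (sym (cong₂ (adj H) (to-spec a) (to-spec b))))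
    (det𝔽₂-reindex size-permuteSubset positions (inducedAdj H U)))

QGraph-iso : ∀ {n m} (G : SimpleGraph n) (H : SimpleGraph m) → GraphIso G H → ∀ u → QGraph G u ≡ QGraph H u
QGraph-iso {n} G H iso u with Perm.↔⇒≡ (GraphIso.σ iso)
... | refl = begin
  QGraph G u                                            ≡⟨ QGraph-subsetSum G u ⟩
  sumList (term G) (subsets n)                          ≡⟨ sumList-subsets-permute n σ (term G) ⟨
  sumList (term G ∘ permuteSubset σ) (subsets n)        ≡⟨ sumList-cong (subsets n) (λ U →
                                                             cong₂ (λ s ν → u ^ (n ∸ s) * ℤ.+ ν)
                                                               (size-permuteSubset σ U)
                                                               (νInduced-permuteSubset σ U G H (GraphIso.preserve iso))) ⟩
  sumList (term H) (subsets n)                          ≡⟨ QGraph-subsetSum H u ⟨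
  QGraph H u                                            ∎
  where
  open ≡-Reasoning
  σ = GraphIso.σ iso
  term : SimpleGraph n → Vec Bool n → ℤ
  term K U = u ^ (n ∸ size U) * ℤ.+ νInduced K U

-- Chords on a line and their crossing matrix

dir : ℕ → ℕ → ℤ
dir p q = if ⌊ p <? q ⌋ then 1ℤ else if ⌊ q <? p ⌋ then -1ℤ else 0ℤ

inside : ℕ → ℕ → ℕ → ℤ
inside l h q = if ⌊ l <? q ⌋ ∧ ⌊ q <? h ⌋ then 1ℤ else 0ℤ

private
  ≮∧≯⇒≡ : ∀ {p q} → ¬ p < q → ¬ q < p → p ≡ q
  ≮∧≯⇒≡ p≮q q≮p = ℕP.≤-antisym (ℕP.≮⇒≥ q≮p) (ℕP.≮⇒≥ p≮q)

  ≮∧≢⇒> : ∀ {p q} → ¬ p < q → p ≢ q → q < p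
  ≮∧≢⇒> p≮q p≢q = ℕP.≤∧≢⇒< (ℕP.≮⇒≥ p≮q) (p≢q ∘ sym)

dir-< : ∀ {p q} → p < q → dir p q ≡ 1ℤ
dir-< {p} {q} p<q with p <? q
... | yes _   = refl
... | no p≮q = ⊥-elim (p≮q p<q)

dir-> : ∀ {p q} → q < p → dir p q ≡ -1ℤ
dir-> {p} {q} q<p with p <? q | q <? p
... | yes p<q | _       = ⊥-elim (ℕP.<-asym p<q q<p)
... | no _    | yes _   = refl
... | no _    | no q≮p = ⊥-elim (q≮p q<p)

dir-refl : ∀ p → dir p p ≡ 0ℤ
dir-refl p with p <? p
... | yes p<p = ⊥-elim (ℕP.<-irrefl refl p<p)
... | no _    = refl

dir-anti : ∀ p q → dir q p ≡ - dir p q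
dir-anti p q with p <? q | q <? p
... | yes p<q | yes q<p = ⊥-elim (ℕP.<-asym p<q q<p)
... | yes _   | no _    = refl
... | no _    | yes _   = refl
... | no _    | no _    = refl

dir-+ : ∀ c p q → dir (c ℕ.+ p) (c ℕ.+ q) ≡ dir p q
dir-+ c p q with p <? q | q <? p
... | yes p<q | _       = dir-< (ℕP.+-monoʳ-< c p<q)
... | no _    | yes q<p = dir-> (ℕP.+-monoʳ-< c q<p)
... | no p≮q  | no q≮p  rewrite ≮∧≯⇒≡ p≮q q≮p = dir-refl (c ℕ.+ q)

inside-in : ∀ {l h q} → l < q → q < h → inside l h q ≡ 1ℤ
inside-in {l} {h} {q} l<q q<h with l <? q | q <? h
... | yes _   | yes _   = refl
... | no l≮q  | _       = ⊥-elim (l≮q l<q)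
... | yes _   | no q≮h  = ⊥-elim (q≮h q<h)

inside-≤ : ∀ {l h q} → q ℕ.≤ l → inside l h q ≡ 0ℤ
inside-≤ {l} {h} {q} q≤l with l <? q
... | yes l<q = ⊥-elim (ℕP.<⇒≱ l<q q≤l)
... | no _    = refl

inside-≥ : ∀ {l h q} → h ℕ.≤ q → inside l h q ≡ 0ℤ
inside-≥ {l} {h} {q} h≤q with l <? q | q <? h
... | yes _ | yes q<h = ⊥-elim (ℕP.<⇒≱ q<h h≤q)
... | yes _ | no _    = refl
... | no _  | _       = refl

inside-dir : ∀ {l h} q → l < h → q ≢ l → q ≢ h → ℤ.+ 2 * inside l h q ≡ dir l q - dir h q
inside-dir {l} {h} q l<h q≢l q≢h with ℕP.<-cmp q l | ℕP.<-cmp q h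
... | tri< q<l _ _ | _            = begin
  ℤ.+ 2 * inside l h q   ≡⟨ cong (ℤ.+ 2 *_) (inside-≤ (ℕP.<⇒≤ q<l)) ⟩
  0ℤ                     ≡⟨ cong₂ _-_ (dir-> q<l) (dir-> (ℕP.<-trans q<l l<h)) ⟨
  dir l q - dir h q      ∎
  where open ≡-Reasoning
... | tri≈ _ q≡l _ | _            = ⊥-elim (q≢l q≡l)
... | tri> _ _ l<q | tri< q<h _ _ = trans (cong (ℤ.+ 2 *_) (inside-in l<q q<h)) (sym (cong₂ _-_ (dir-< l<q) (dir-> q<h)))
... | tri> _ _ _   | tri≈ _ q≡h _ = ⊥-elim (q≢h q≡h)
... | tri> _ _ l<q | tri> _ _ h<q = trans (cong (ℤ.+ 2 *_) (inside-≥ (ℕP.<⇒≤ h<q))) (sym (cong₂ _-_ (dir-< l<q) (dir-< h<q)))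

Crossing : ℕ → ℕ → ℕ → ℕ → Set
Crossing l h l′ h′ = l < l′ × l′ < h × h < h′

inside-≢⇒crossing : ∀ {l h l′ h′} → l < h → l′ < h′ → l ≢ l′ → h ≢ h′ →
  inside l h l′ ≢ inside l h h′ → Crossing l h l′ h′ ⊎ Crossing l′ h′ l h
inside-≢⇒crossing {l} {h} {l′} {h′} l<h l′<h′ l≢l′ h≢h′ ≢ with l <? l′ | l′ <? h | l <? h′ | h′ <? h
... | yes _   | yes _   | yes _   | yes _   = ⊥-elim (≢ refl)
... | yes a   | yes b   | yes _   | no d    = inj₁ (a , b , ≮∧≢⇒> d (h≢h′ ∘ sym))
... | yes a   | yes _   | no c    | _       = ⊥-elim (c (ℕP.<-trans a l′<h′))
... | yes _   | no b    | yes _   | yes d   = ⊥-elim (b (ℕP.<-trans l′<h′ d))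
... | yes _   | no _    | yes _   | no _    = ⊥-elim (≢ refl)
... | yes _   | no _    | no _    | _       = ⊥-elim (≢ refl)
... | no a    | yes _   | yes c   | yes d   = inj₂ (≮∧≢⇒> a l≢l′ , c , d)
... | no _    | yes _   | yes _   | no _    = ⊥-elim (≢ refl)
... | no _    | yes _   | no _    | _       = ⊥-elim (≢ refl)
... | no a    | no _    | yes c   | yes d   = inj₂ (≮∧≢⇒> a l≢l′ , c , d)
... | no _    | no _    | yes _   | no _    = ⊥-elim (≢ refl)
... | no _    | no _    | no _    | _       = ⊥-elim (≢ refl)

module _ {a b : ℕ} where
  lower upper : Dec (a < b) → ℕ
  lower (yes _) = a
  lower (no _)  = b
  upper (yes _) = b
  upper (no _)  = a

  orientation : Dec (a < b) → ℤ
  orientation (yes _) = 1ℤ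
  orientation (no _)  = -1ℤ

data Oriented (a b lo hi : ℕ) (t : ℤ) : Set where
  forward  : a ≡ lo → b ≡ hi → t ≡ 1ℤ  → Oriented a b lo hi t
  backward : a ≡ hi → b ≡ lo → t ≡ -1ℤ → Oriented a b lo hi t

oriented : ∀ {a b} (a<?b : Dec (a < b)) → Oriented a b (lower a<?b) (upper a<?b) (orientation a<?b)
oriented (yes _) = forward refl refl refl
oriented (no _)  = backward refl refl refl

private
  square-product : ∀ s t → s * s ≡ 1ℤ → t * t ≡ 1ℤ → (s * t) * (s * t) ≡ 1ℤ
  square-product s t s²≡1 t²≡1 = trans (regroup s t) (cong₂ _*_ s²≡1 t²≡1)
    where regroup : ∀ a b → (a * b) * (a * b) ≡ (a * a) * (b * b)
          regroup = solve-∀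

-- Chord c joins x c and y c in either direction: pivoting can reverse chords.
record Chords (n : ℕ) : Set where
  field
    x y      : Fin n → ℕ
    x≢y      : ∀ c → x c ≢ y c
    apart    : ∀ c d → c ≢ d → (x c ≢ x d) × (x c ≢ y d) × (y c ≢ y d)

module _ {n} (D : Chords n) where
  open Chords D

  lo hi : Fin n → ℕ
  lo i = lower (x i <? y i)
  hi i = upper (x i <? y i)

  τ : Fin n → ℤ
  τ i = orientation (x i <? y i)

  -- ε i k = ± 1 if chords i and k cross, the sign recording their directions, and 0 otherwise.
  ε : Matrix n
  ε i k = τ i * (inside (lo i) (hi i) (x k) - inside (lo i) (hi i) (y k))

  orient : ∀ i → Oriented (x i) (y i) (lo i) (hi i) (τ i)
  orient i = oriented (x i <? y i)

  lo<hi : ∀ i → lo i < hi i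
  lo<hi i with x i <? y i
  ... | yes x<y = x<y
  ... | no x≮y  = ≮∧≢⇒> x≮y (x≢y i)

  τ² : ∀ i → τ i * τ i ≡ 1ℤ
  τ² i with x i <? y i
  ... | yes _ = refl
  ... | no _  = refl

  IsEnd : Fin n → ℕ → Set
  IsEnd i p = p ≡ x i ⊎ p ≡ y i

  lo-isEnd : ∀ i → IsEnd i (lo i)
  lo-isEnd i with orient i
  ... | forward  x≡lo _ _ = inj₁ (sym x≡lo)
  ... | backward _ y≡lo _ = inj₂ (sym y≡lo)

  hi-isEnd : ∀ i → IsEnd i (hi i)
  hi-isEnd i with orient i
  ... | forward  _ y≡hi _ = inj₂ (sym y≡hi)
  ... | backward x≡hi _ _ = inj₁ (sym x≡hi)

  ends-distinct : ∀ {i j} → i ≢ j → ∀ {p q} → IsEnd i p → IsEnd j q → p ≢ q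
  ends-distinct i≢j (inj₁ refl) (inj₁ refl) = proj₁ (apart _ _ i≢j)
  ends-distinct i≢j (inj₁ refl) (inj₂ refl) = proj₁ (proj₂ (apart _ _ i≢j))
  ends-distinct i≢j (inj₂ refl) (inj₁ refl) = proj₁ (proj₂ (apart _ _ (i≢j ∘ sym))) ∘ sym
  ends-distinct i≢j (inj₂ refl) (inj₂ refl) = proj₂ (proj₂ (apart _ _ i≢j))

  ε-diag : ∀ i → ε i i ≡ 0ℤ
  ε-diag i = trans (cong (τ i *_) (ends-outside (orient i))) (ℤP.*-zeroʳ (τ i))
    where
    I : ℕ → ℤ
    I = inside (lo i) (hi i)
    at-lo : I (lo i) ≡ 0ℤ
    at-lo = inside-≤ {lo i} {hi i} ℕP.≤-refl
    at-hi : I (hi i) ≡ 0ℤ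
    at-hi = inside-≥ {lo i} {hi i} ℕP.≤-refl
    ends-outside : Oriented (x i) (y i) (lo i) (hi i) (τ i) → I (x i) - I (y i) ≡ 0ℤ
    ends-outside (forward x≡lo y≡hi _)  = cong₂ _-_ (trans (cong I x≡lo) at-lo) (trans (cong I y≡hi) at-hi)
    ends-outside (backward x≡hi y≡lo _) = cong₂ _-_ (trans (cong I x≡hi) at-hi) (trans (cong I y≡lo) at-lo)

  τ-inside-dir : ∀ i q → q ≢ x i → q ≢ y i → ℤ.+ 2 * (τ i * inside (lo i) (hi i) q) ≡ dir (x i) q - dir (y i) q
  τ-inside-dir i q q≢x q≢y with orient i
  ... | forward x≡lo y≡hi τ≡1 = begin
    ℤ.+ 2 * (τ i * inside (lo i) (hi i) q)   ≡⟨ cong (λ t → ℤ.+ 2 * (t * inside (lo i) (hi i) q)) τ≡1 ⟩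
    ℤ.+ 2 * (1ℤ * inside (lo i) (hi i) q)    ≡⟨ cong (ℤ.+ 2 *_) (ℤP.*-identityˡ (inside (lo i) (hi i) q)) ⟩
    ℤ.+ 2 * inside (lo i) (hi i) q           ≡⟨ inside-dir q (lo<hi i) (λ e → q≢x (trans e (sym x≡lo)))
                                                                     (λ e → q≢y (trans e (sym y≡hi))) ⟩
    dir (lo i) q - dir (hi i) q              ≡⟨ cong₂ (λ a b → dir a q - dir b q) x≡lo y≡hi ⟨
    dir (x i) q - dir (y i) q                ∎
    where open ≡-Reasoning
  ... | backward x≡hi y≡lo τ≡-1 = begin
    ℤ.+ 2 * (τ i * inside (lo i) (hi i) q)   ≡⟨ cong (λ t → ℤ.+ 2 * (t * inside (lo i) (hi i) q)) τ≡-1 ⟩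
    ℤ.+ 2 * (-1ℤ * inside (lo i) (hi i) q)   ≡⟨ negate (inside (lo i) (hi i) q) ⟩
    - (ℤ.+ 2 * inside (lo i) (hi i) q)       ≡⟨ cong -_ (inside-dir q (lo<hi i) (λ e → q≢y (trans e (sym y≡lo)))
                                                                                (λ e → q≢x (trans e (sym x≡hi)))) ⟩
    - (dir (lo i) q - dir (hi i) q)          ≡⟨ flip (dir (lo i) q) (dir (hi i) q) ⟩
    dir (hi i) q - dir (lo i) q              ≡⟨ cong₂ (λ a b → dir a q - dir b q) x≡hi y≡lo ⟨
    dir (x i) q - dir (y i) q                ∎
    where
    open ≡-Reasoning
    negate : ∀ I → ℤ.+ 2 * (-1ℤ * I) ≡ - (ℤ.+ 2 * I)
    negate = solve-∀
    flip : ∀ a b → - (a - b) ≡ b - a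
    flip = solve-∀

  -- Twice ε only depends on the relative order of the endpoints, which the arc shuffle controls.
  ε-dir : ∀ {i k} → i ≢ k →
    ℤ.+ 2 * ε i k ≡ (dir (x i) (x k) - dir (y i) (x k)) - (dir (x i) (y k) - dir (y i) (y k))
  ε-dir {i} {k} i≢k = trans (distrib (τ i) (inside (lo i) (hi i) (x k)) (inside (lo i) (hi i) (y k)))
    (cong₂ _-_ (τ-inside-dir i (x k) (proj₁ (apart k i k≢i)) (proj₁ (proj₂ (apart k i k≢i))))
               (τ-inside-dir i (y k) (proj₁ (proj₂ (apart i k i≢k)) ∘ sym) (proj₂ (proj₂ (apart k i k≢i)))))
    where
    k≢i : k ≢ i
    k≢i = i≢k ∘ sym
    distrib : ∀ t a b → ℤ.+ 2 * (t * (a - b)) ≡ ℤ.+ 2 * (t * a) - ℤ.+ 2 * (t * b)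
    distrib = solve-∀

  ε-anti : ∀ i k → ε k i ≡ - ε i k
  ε-anti i k with i Fin.≟ k
  ... | yes refl = trans (ε-diag i) (cong -_ (sym (ε-diag i)))
  ... | no i≢k   = ℤP.*-cancelˡ-≡ (ℤ.+ 2) (ε k i) (- ε i k) (begin
    ℤ.+ 2 * ε k i
      ≡⟨ ε-dir (i≢k ∘ sym) ⟩
    (dir (x k) (x i) - dir (y k) (x i)) - (dir (x k) (y i) - dir (y k) (y i))
      ≡⟨ cong₂ (λ a b → (a - b) - (dir (x k) (y i) - dir (y k) (y i))) (dir-anti (x i) (x k)) (dir-anti (x i) (y k)) ⟩
    (- dir (x i) (x k) - - dir (x i) (y k)) - (dir (x k) (y i) - dir (y k) (y i))
      ≡⟨ cong₂ (λ a b → (- dir (x i) (x k) - - dir (x i) (y k)) - (a - b)) (dir-anti (y i) (x k)) (dir-anti (y i) (y k)) ⟩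
    (- dir (x i) (x k) - - dir (x i) (y k)) - (- dir (y i) (x k) - - dir (y i) (y k))
      ≡⟨ regroup (dir (x i) (x k)) (dir (x i) (y k)) (dir (y i) (x k)) (dir (y i) (y k)) ⟩
    - ((dir (x i) (x k) - dir (y i) (x k)) - (dir (x i) (y k) - dir (y i) (y k)))
      ≡⟨ cong -_ (ε-dir i≢k) ⟨
    - (ℤ.+ 2 * ε i k)
      ≡⟨ ℤP.neg-distribʳ-* (ℤ.+ 2) (ε i k) ⟩
    ℤ.+ 2 * - ε i k ∎)
    where
    open ≡-Reasoning
    regroup : ∀ a b c d → (- a - - b) - (- c - - d) ≡ - ((a - c) - (b - d))
    regroup = solve-∀

  crossing : ∀ {a b} → a ≢ b → ε a b ≢ 0ℤ → Crossing (lo a) (hi a) (lo b) (hi b) ⊎ Crossing (lo b) (hi b) (lo a) (hi a)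
  crossing {a} {b} a≢b εab≢0 = inside-≢⇒crossing (lo<hi a) (lo<hi b)
    (ends-distinct a≢b (lo-isEnd a) (lo-isEnd b)) (ends-distinct a≢b (hi-isEnd a) (hi-isEnd b)) inside≢
    where
    I : ℕ → ℤ
    I = inside (lo a) (hi a)
    inside≢ : I (lo b) ≢ I (hi b)
    inside≢ I≡ = εab≢0 (trans (cong (τ a *_) (ends-cancel (orient b))) (ℤP.*-zeroʳ (τ a)))
      where
      ends-cancel : Oriented (x b) (y b) (lo b) (hi b) (τ b) → I (x b) - I (y b) ≡ 0ℤ
      ends-cancel (forward x≡lo y≡hi _) =
        trans (cong₂ (λ p q → I p - I q) x≡lo y≡hi) (trans (cong (_- I (hi b)) I≡) (ℤP.+-inverseʳ (I (hi b))))
      ends-cancel (backward x≡hi y≡lo _) =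
        trans (cong₂ (λ p q → I p - I q) x≡hi y≡lo) (trans (cong (λ z → I (hi b) - z) I≡) (ℤP.+-inverseʳ (I (hi b))))

  ε-crossing : ∀ {a b} → Crossing (lo a) (hi a) (lo b) (hi b) → ε a b ≡ τ a * τ b
  ε-crossing {a} {b} (la<lb , lb<ha , ha<hb) = cong (τ a *_) (ends (orient b))
    where
    I : ℕ → ℤ
    I = inside (lo a) (hi a)
    ends : Oriented (x b) (y b) (lo b) (hi b) (τ b) → I (x b) - I (y b) ≡ τ b
    ends (forward x≡lo y≡hi τ≡1) = trans (cong₂ (λ p q → I p - I q) x≡lo y≡hi)
      (trans (cong₂ _-_ (inside-in la<lb lb<ha) (inside-≥ (ℕP.<⇒≤ ha<hb))) (sym τ≡1))
    ends (backward x≡hi y≡lo τ≡-1) = trans (cong₂ (λ p q → I p - I q) x≡hi y≡lo)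
      (trans (cong₂ _-_ (inside-≥ (ℕP.<⇒≤ ha<hb)) (inside-in la<lb lb<ha)) (sym τ≡-1))

  ε²≡1 : ∀ {a b} → a ≢ b → ε a b ≢ 0ℤ → ε a b * ε a b ≡ 1ℤ
  ε²≡1 {a} {b} a≢b εab≢0 with crossing a≢b εab≢0
  ... | inj₁ ab = trans (cong (λ e → e * e) (ε-crossing ab)) (square-product (τ a) (τ b) (τ² a) (τ² b))
  ... | inj₂ ba = trans (cong (λ e → e * e) (trans (ε-anti b a) (cong -_ (ε-crossing ba))))
                        (trans (neg-square (τ b * τ a)) (square-product (τ b) (τ a) (τ² b) (τ² a)))
    where neg-square : ∀ e → - e * - e ≡ e * e
          neg-square = solve-∀

-- Pivoting on two crossing chords

data Arc : Set where
  before P Q R after : Arc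

rank : Arc → ℕ
rank before = 0
rank R      = 1
rank Q      = 2
rank P      = 3
rank after  = 4

isP isQ isR : Arc → ℤ
isP P = 1ℤ
isP _ = 0ℤ
isQ Q = 1ℤ
isQ _ = 0ℤ
isR R = 1ℤ
isR _ = 0ℤ

-- dir (shuffle p) (shuffle q) - dir p q for p in arc s and q in arc t (see dir-shuffle),
-- written as a polynomial in the arc indicators for the ring solver.
correction : Arc → Arc → ℤ
correction s t = ℤ.-[1+ 1 ] * (isP s * isQ t - isQ s * isP t + isP s * isR t - isR s * isP t + isQ s * isR t - isR s * isQ t)

+-<-lex : ∀ {K m m′ p q} → m < m′ → p < K → q < K → m ℕ.* K ℕ.+ p < m′ ℕ.* K ℕ.+ q
+-<-lex {K} {m} {m′} {p} {q} m<m′ p<K q<K = begin-strict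
  m ℕ.* K ℕ.+ p     <⟨ ℕP.+-monoʳ-< (m ℕ.* K) p<K ⟩
  m ℕ.* K ℕ.+ K     ≡⟨ ℕP.+-comm (m ℕ.* K) K ⟩
  suc m ℕ.* K       ≤⟨ ℕP.*-monoˡ-≤ K m<m′ ⟩
  m′ ℕ.* K          ≤⟨ ℕP.m≤m+n (m′ ℕ.* K) q ⟩
  m′ ℕ.* K ℕ.+ q    ∎
  where open ℕP.≤-Reasoning

-- For crossing chords with endpoints p₁ < p₂ < p₃ < p₄, reversing the order of the arcs
-- P = (p₁, p₂), Q = (p₂, p₃) and R = (p₃, p₄), keeping the order inside each arc, turns the
-- crossing matrix into its pivot on the two chords (ε-mutate).  When K bounds all endpoints,
-- shuffle realises the new order on ℕ.
module Mutation (p₁ p₂ p₃ p₄ : ℕ) (p₁<p₂ : p₁ < p₂) (p₂<p₃ : p₂ < p₃) (p₃<p₄ : p₃ < p₄) (K : ℕ) where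

  data InArc (q : ℕ) : Arc → Set where
    in-before : q < p₁           → InArc q before
    in-P      : p₁ < q → q < p₂ → InArc q P
    in-Q      : p₂ < q → q < p₃ → InArc q Q
    in-R      : p₃ < q → q < p₄ → InArc q R
    in-after  : p₄ < q           → InArc q after

  Generic : ℕ → Set
  Generic q = q ≢ p₁ × q ≢ p₂ × q ≢ p₃ × q ≢ p₄

  arc : ℕ → Arc
  arc q with q <? p₁ | q <? p₂ | q <? p₃ | q <? p₄
  ... | yes _ | _     | _     | _     = before
  ... | no _  | yes _ | _     | _     = P
  ... | no _  | no _  | yes _ | _     = Q
  ... | no _  | no _  | no _  | yes _ = R
  ... | no _  | no _  | no _  | no _  = after

  inArc : ∀ q → Generic q → InArc q (arc q)
  inArc q (q≢p₁ , q≢p₂ , q≢p₃ , q≢p₄) with q <? p₁ | q <? p₂ | q <? p₃ | q <? p₄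
  ... | yes q<p₁ | _        | _        | _        = in-before q<p₁
  ... | no q≮p₁  | yes q<p₂ | _        | _        = in-P (≮∧≢⇒> q≮p₁ q≢p₁) q<p₂
  ... | no _     | no q≮p₂  | yes q<p₃ | _        = in-Q (≮∧≢⇒> q≮p₂ q≢p₂) q<p₃
  ... | no _     | no _     | no q≮p₃  | yes q<p₄ = in-R (≮∧≢⇒> q≮p₃ q≢p₃) q<p₄
  ... | no _     | no _     | no _     | no q≮p₄  = in-after (≮∧≢⇒> q≮p₄ q≢p₄)

  shuffle : ℕ → ℕ
  shuffle q = rank (arc q) ℕ.* K ℕ.+ q

  private
    p₁<p₃ : p₁ < p₃
    p₁<p₃ = ℕP.<-trans p₁<p₂ p₂<p₃
    p₂<p₄ : p₂ < p₄
    p₂<p₄ = ℕP.<-trans p₂<p₃ p₃<p₄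
    p₁<p₄ : p₁ < p₄
    p₁<p₄ = ℕP.<-trans p₁<p₃ p₃<p₄

    correction-self : ∀ s → correction s s ≡ 0ℤ
    correction-self s = vanish (isP s) (isQ s) (isR s)
      where vanish : ∀ a b c → ℤ.-[1+ 1 ] * (a * b - b * a + a * c - c * a + b * c - c * b) ≡ 0ℤ
            vanish = solve-∀

    same : ∀ s p q → dir (rank s ℕ.* K ℕ.+ p) (rank s ℕ.* K ℕ.+ q) ≡ dir p q + correction s s
    same s p q = trans (dir-+ (rank s ℕ.* K) p q)
      (sym (trans (cong (dir p q +_) (correction-self s)) (ℤP.+-identityʳ (dir p q))))

    up : ∀ s t {p q} {_ : True (rank s <? rank t)} → p < K → q < K →
         dir p q + correction s t ≡ 1ℤ → dir (rank s ℕ.* K ℕ.+ p) (rank t ℕ.* K ℕ.+ q) ≡ dir p q + correction s t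
    up s t {_} {_} {rs<rt} p<K q<K d≡1 = trans (dir-< (+-<-lex (toWitness rs<rt) p<K q<K)) (sym d≡1)

    down : ∀ s t {p q} {_ : True (rank t <? rank s)} → p < K → q < K →
           dir p q + correction s t ≡ -1ℤ → dir (rank s ℕ.* K ℕ.+ p) (rank t ℕ.* K ℕ.+ q) ≡ dir p q + correction s t
    down s t {_} {_} {rt<rs} p<K q<K d≡-1 = trans (dir-> (+-<-lex (toWitness rt<rs) q<K p<K)) (sym d≡-1)

  dir-shuffle : ∀ {p q s t} → InArc p s → InArc q t → p < K → q < K →
    dir (rank s ℕ.* K ℕ.+ p) (rank t ℕ.* K ℕ.+ q) ≡ dir p q + correction s t
  dir-shuffle {p} {q} (in-before _)    (in-before _)    _   _   = same before p q
  dir-shuffle (in-before p<)   (in-P l _)       p<K q<K = up before P p<K q<K (cong (_+ 0ℤ) (dir-< (ℕP.<-trans p< l)))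
  dir-shuffle (in-before p<)   (in-Q l _)       p<K q<K = up before Q p<K q<K (cong (_+ 0ℤ) (dir-< (ℕP.<-trans p< (ℕP.<-trans p₁<p₂ l))))
  dir-shuffle (in-before p<)   (in-R l _)       p<K q<K = up before R p<K q<K (cong (_+ 0ℤ) (dir-< (ℕP.<-trans p< (ℕP.<-trans p₁<p₃ l))))
  dir-shuffle (in-before p<)   (in-after l)     p<K q<K = up before after p<K q<K (cong (_+ 0ℤ) (dir-< (ℕP.<-trans p< (ℕP.<-trans p₁<p₄ l))))
  dir-shuffle (in-P l _)       (in-before q<)   p<K q<K = down P before p<K q<K (cong (_+ 0ℤ) (dir-> (ℕP.<-trans q< l)))
  dir-shuffle {p} {q} (in-P _ _)       (in-P _ _)       _   _   = same P p q
  dir-shuffle (in-P _ u)       (in-Q l _)       p<K q<K = down P Q p<K q<K (cong (_+ ℤ.-[1+ 1 ]) (dir-< (ℕP.<-trans u l)))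
  dir-shuffle (in-P _ u)       (in-R l _)       p<K q<K = down P R p<K q<K (cong (_+ ℤ.-[1+ 1 ]) (dir-< (ℕP.<-trans u (ℕP.<-trans p₂<p₃ l))))
  dir-shuffle (in-P _ u)       (in-after l)     p<K q<K = up P after p<K q<K (cong (_+ 0ℤ) (dir-< (ℕP.<-trans u (ℕP.<-trans p₂<p₄ l))))
  dir-shuffle (in-Q l _)       (in-before q<)   p<K q<K = down Q before p<K q<K (cong (_+ 0ℤ) (dir-> (ℕP.<-trans q< (ℕP.<-trans p₁<p₂ l))))
  dir-shuffle (in-Q l _)       (in-P _ u)       p<K q<K = up Q P p<K q<K (cong (_+ ℤ.+ 2) (dir-> (ℕP.<-trans u l)))
  dir-shuffle {p} {q} (in-Q _ _)       (in-Q _ _)       _   _   = same Q p q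
  dir-shuffle (in-Q _ u)       (in-R l _)       p<K q<K = down Q R p<K q<K (cong (_+ ℤ.-[1+ 1 ]) (dir-< (ℕP.<-trans u l)))
  dir-shuffle (in-Q _ u)       (in-after l)     p<K q<K = up Q after p<K q<K (cong (_+ 0ℤ) (dir-< (ℕP.<-trans u (ℕP.<-trans p₃<p₄ l))))
  dir-shuffle (in-R l _)       (in-before q<)   p<K q<K = down R before p<K q<K (cong (_+ 0ℤ) (dir-> (ℕP.<-trans q< (ℕP.<-trans p₁<p₃ l))))
  dir-shuffle (in-R l _)       (in-P _ u)       p<K q<K = up R P p<K q<K (cong (_+ ℤ.+ 2) (dir-> (ℕP.<-trans u (ℕP.<-trans p₂<p₃ l))))
  dir-shuffle (in-R l _)       (in-Q _ u)       p<K q<K = up R Q p<K q<K (cong (_+ ℤ.+ 2) (dir-> (ℕP.<-trans u l)))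
  dir-shuffle {p} {q} (in-R _ _)       (in-R _ _)       _   _   = same R p q
  dir-shuffle (in-R _ u)       (in-after l)     p<K q<K = up R after p<K q<K (cong (_+ 0ℤ) (dir-< (ℕP.<-trans u l)))
  dir-shuffle (in-after l)     (in-before q<)   p<K q<K = down after before p<K q<K (cong (_+ 0ℤ) (dir-> (ℕP.<-trans q< (ℕP.<-trans p₁<p₄ l))))
  dir-shuffle (in-after l)     (in-P _ u)       p<K q<K = down after P p<K q<K (cong (_+ 0ℤ) (dir-> (ℕP.<-trans u (ℕP.<-trans p₂<p₄ l))))
  dir-shuffle (in-after l)     (in-Q _ u)       p<K q<K = down after Q p<K q<K (cong (_+ 0ℤ) (dir-> (ℕP.<-trans u (ℕP.<-trans p₃<p₄ l))))
  dir-shuffle (in-after l)     (in-R _ u)       p<K q<K = down after R p<K q<K (cong (_+ 0ℤ) (dir-> (ℕP.<-trans u l)))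
  dir-shuffle {p} {q} (in-after _)     (in-after _)     _   _   = same after p q

  inside-P∪Q : ∀ {q s} → InArc q s → inside p₁ p₃ q ≡ isP s + isQ s
  inside-P∪Q (in-before u) = inside-≤ (ℕP.<⇒≤ u)
  inside-P∪Q (in-P l u)    = inside-in l (ℕP.<-trans u p₂<p₃)
  inside-P∪Q (in-Q l u)    = inside-in (ℕP.<-trans p₁<p₂ l) u
  inside-P∪Q (in-R l u)    = inside-≥ (ℕP.<⇒≤ l)
  inside-P∪Q (in-after l)  = inside-≥ (ℕP.<⇒≤ (ℕP.<-trans p₃<p₄ l))

  inside-Q∪R : ∀ {q s} → InArc q s → inside p₂ p₄ q ≡ isQ s + isR s
  inside-Q∪R (in-before u) = inside-≤ (ℕP.<⇒≤ (ℕP.<-trans u p₁<p₂))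
  inside-Q∪R (in-P l u)    = inside-≤ (ℕP.<⇒≤ u)
  inside-Q∪R (in-Q l u)    = inside-in l (ℕP.<-trans u p₃<p₄)
  inside-Q∪R (in-R l u)    = inside-in (ℕP.<-trans p₂<p₃ l) u
  inside-Q∪R (in-after l)  = inside-≥ (ℕP.<⇒≤ l)

  shuffle-injective : ∀ {p q s t} → InArc p s → InArc q t → p < K → q < K →
    rank s ℕ.* K ℕ.+ p ≡ rank t ℕ.* K ℕ.+ q → p ≡ q
  shuffle-injective {p} {q} {s} {t} _ _ p<K q<K eq with ℕP.<-cmp (rank s) (rank t)
  ... | tri< rs<rt _ _ = ⊥-elim (ℕP.<-irrefl eq (+-<-lex rs<rt p<K q<K))
  ... | tri> _ _ rt<rs = ⊥-elim (ℕP.<-irrefl (sym eq) (+-<-lex rt<rs q<K p<K))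
  ... | tri≈ _ rs≡rt _ rewrite rs≡rt = ℕP.+-cancelˡ-≡ (rank t ℕ.* K) p q eq

module Pivoting {n} (D : Chords n) {a b : Fin n} (a≢b : a ≢ b) (cross : Crossing (lo D a) (hi D a) (lo D b) (hi D b))
                (K : ℕ) (x<K : ∀ i → Chords.x D i < K) (y<K : ∀ i → Chords.y D i < K) where
  open Chords D
  open Mutation (lo D a) (lo D b) (hi D a) (hi D b) (proj₁ cross) (proj₁ (proj₂ cross)) (proj₂ (proj₂ cross)) K

  Away : Fin n → Set
  Away i = i ≢ a × i ≢ b

  generic : ∀ {i} → Away i → ∀ {p} → IsEnd D i p → Generic p
  generic (i≢a , i≢b) e = ends-distinct D i≢a e (lo-isEnd D a) , ends-distinct D i≢b e (lo-isEnd D b)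
                        , ends-distinct D i≢a e (hi-isEnd D a) , ends-distinct D i≢b e (hi-isEnd D b)

  shuffle-≢ : ∀ {p q} → Generic p → Generic q → p < K → q < K → p ≢ q → shuffle p ≢ shuffle q
  shuffle-≢ {p} {q} gp gq p<K q<K p≢q = p≢q ∘ shuffle-injective (inArc p gp) (inArc q gq) p<K q<K

  module _ {m} (ι : Fin m → Fin n) (away : ∀ r → Away (ι r)) (ι-injective : ∀ {r s} → ι r ≡ ι s → r ≡ s) where

    mutate : Chords m
    mutate = record
      { x        = shuffle ∘ x ∘ ι
      ; y        = shuffle ∘ y ∘ ι
      ; x≢y      = λ r → shuffle-≢ (gx r) (gy r) (x<K (ι r)) (y<K (ι r)) (x≢y (ι r))
      ; apart    = λ r s r≢s → let ι≢ = r≢s ∘ ι-injective in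
          shuffle-≢ (gx r) (gx s) (x<K (ι r)) (x<K (ι s)) (proj₁ (apart (ι r) (ι s) ι≢)) ,
          shuffle-≢ (gx r) (gy s) (x<K (ι r)) (y<K (ι s)) (proj₁ (proj₂ (apart (ι r) (ι s) ι≢))) ,
          shuffle-≢ (gy r) (gy s) (y<K (ι r)) (y<K (ι s)) (proj₂ (proj₂ (apart (ι r) (ι s) ι≢)))
      }
      where
      gx : ∀ r → Generic (x (ι r))
      gx r = generic (away r) (inj₁ refl)
      gy : ∀ r → Generic (y (ι r))
      gy r = generic (away r) (inj₂ refl)

    pivoted : Fin m → Fin m → ℤ
    pivoted r s = ε D (ι r) (ι s) - ε D a b * (ε D a (ι s) * ε D (ι r) b - ε D b (ι s) * ε D (ι r) a)

    ε-mutate-diag : ∀ r → ε mutate r r ≡ pivoted r r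
    ε-mutate-diag r = trans (ε-diag mutate r) (sym (begin
      pivoted r r
        ≡⟨ cong₂ (λ f g → ε D i i - ε D a b * (ε D a i * f - ε D b i * g)) (ε-anti D b i) (ε-anti D a i) ⟩
      ε D i i - ε D a b * (ε D a i * - ε D b i - ε D b i * - ε D a i)
        ≡⟨ cong (λ z → ε D i i - ε D a b * z) (cancel (ε D a i) (ε D b i)) ⟩
      ε D i i - ε D a b * 0ℤ
        ≡⟨ cong (λ z → ε D i i - z) (ℤP.*-zeroʳ (ε D a b)) ⟩
      ε D i i - 0ℤ
        ≡⟨ ℤP.+-identityʳ (ε D i i) ⟩
      ε D i i
        ≡⟨ ε-diag D i ⟩
      0ℤ ∎))
      where
      open ≡-Reasoning
      i = ι r
      cancel : ∀ A B → A * - B - B * - A ≡ 0ℤ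
      cancel = solve-∀

    private
      ends : ∀ t → InArc (x (ι t)) (arc (x (ι t))) × InArc (y (ι t)) (arc (y (ι t)))
      ends t = inArc _ (generic (away t) (inj₁ refl)) , inArc _ (generic (away t) (inj₂ refl))

      inPQ inQR : Fin m → ℤ
      inPQ t = (isP (arc (x (ι t))) + isQ (arc (x (ι t)))) - (isP (arc (y (ι t))) + isQ (arc (y (ι t))))
      inQR t = (isQ (arc (x (ι t))) + isR (arc (x (ι t)))) - (isQ (arc (y (ι t))) + isR (arc (y (ι t))))

      ε-via-P∪Q : ∀ t → ε D a (ι t) ≡ τ D a * inPQ t
      ε-via-P∪Q t = cong (τ D a *_) (cong₂ _-_ (inside-P∪Q (proj₁ (ends t))) (inside-P∪Q (proj₂ (ends t))))

      ε-via-Q∪R : ∀ t → ε D b (ι t) ≡ τ D b * inQR t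
      ε-via-Q∪R t = cong (τ D b *_) (cong₂ _-_ (inside-Q∪R (proj₁ (ends t))) (inside-Q∪R (proj₂ (ends t))))

    arcCorrection : Fin m → Fin m → ℤ
    arcCorrection r s = (correction s₁ s₃ - correction s₂ s₃) - (correction s₁ s₄ - correction s₂ s₄)
      where
      s₁ = arc (x (ι r))
      s₂ = arc (y (ι r))
      s₃ = arc (x (ι s))
      s₄ = arc (y (ι s))

    twice-ε-mutate : ∀ {r s} → r ≢ s → ℤ.+ 2 * ε mutate r s ≡ ℤ.+ 2 * ε D (ι r) (ι s) + arcCorrection r s
    twice-ε-mutate {r} {s} r≢s = begin
      ℤ.+ 2 * ε mutate r s
        ≡⟨ ε-dir mutate r≢s ⟩
      (dir (shuffle (x i)) (shuffle (x k)) - dir (shuffle (y i)) (shuffle (x k)))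
        - (dir (shuffle (x i)) (shuffle (y k)) - dir (shuffle (y i)) (shuffle (y k)))
        ≡⟨ cong₂ _-_ (cong₂ _-_ (dir-shuffle xᵢ xₖ (x<K i) (x<K k)) (dir-shuffle yᵢ xₖ (y<K i) (x<K k)))
                     (cong₂ _-_ (dir-shuffle xᵢ yₖ (x<K i) (y<K k)) (dir-shuffle yᵢ yₖ (y<K i) (y<K k))) ⟩
      ((dir (x i) (x k) + correction s₁ s₃) - (dir (y i) (x k) + correction s₂ s₃))
        - ((dir (x i) (y k) + correction s₁ s₄) - (dir (y i) (y k) + correction s₂ s₄))
        ≡⟨ separate (dir (x i) (x k)) (dir (y i) (x k)) (dir (x i) (y k)) (dir (y i) (y k))
                    (correction s₁ s₃) (correction s₂ s₃) (correction s₁ s₄) (correction s₂ s₄) ⟩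
      ((dir (x i) (x k) - dir (y i) (x k)) - (dir (x i) (y k) - dir (y i) (y k))) + arcCorrection r s
        ≡⟨ cong (_+ arcCorrection r s) (ε-dir D (r≢s ∘ ι-injective)) ⟨
      ℤ.+ 2 * ε D i k + arcCorrection r s ∎
      where
      open ≡-Reasoning
      i = ι r
      k = ι s
      s₁ = arc (x i)
      s₂ = arc (y i)
      s₃ = arc (x k)
      s₄ = arc (y k)
      xᵢ : InArc (x i) s₁
      xᵢ = proj₁ (ends r)
      yᵢ : InArc (y i) s₂
      yᵢ = proj₂ (ends r)
      xₖ : InArc (x k) s₃
      xₖ = proj₁ (ends s)
      yₖ : InArc (y k) s₄
      yₖ = proj₂ (ends s)
      separate : ∀ a₁ a₂ a₃ a₄ c₁ c₂ c₃ c₄ →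
        ((a₁ + c₁) - (a₂ + c₂)) - ((a₃ + c₃) - (a₄ + c₄)) ≡ ((a₁ - a₂) - (a₃ - a₄)) + ((c₁ - c₂) - (c₃ - c₄))
      separate = solve-∀

    arcCorrection≡ : ∀ r s →
      arcCorrection r s ≡ - (ℤ.+ 2 * (ε D a b * (ε D a (ι s) * ε D (ι r) b - ε D b (ι s) * ε D (ι r) a)))
    arcCorrection≡ r s = begin
      arcCorrection r s
        ≡⟨ corrections (isP s₁) (isQ s₁) (isR s₁) (isP s₂) (isQ s₂) (isR s₂)
                       (isP s₃) (isQ s₃) (isR s₃) (isP s₄) (isQ s₄) (isR s₄) ⟩
      ℤ.+ 2 * ((1ℤ * 1ℤ) * (inPQ s * inQR r - inQR s * inPQ r))
        ≡⟨ cong₂ (λ e f → ℤ.+ 2 * ((e * f) * (inPQ s * inQR r - inQR s * inPQ r))) (τ² D a) (τ² D b) ⟨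
      ℤ.+ 2 * ((τ D a * τ D a) * (τ D b * τ D b) * (inPQ s * inQR r - inQR s * inPQ r))
        ≡⟨ expand (τ D a) (τ D b) (inPQ s) (inQR r) (inQR s) (inPQ r) ⟩
      - (ℤ.+ 2 * ((τ D a * τ D b) * ((τ D a * inPQ s) * - (τ D b * inQR r) - (τ D b * inQR s) * - (τ D a * inPQ r))))
        ≡⟨ cong (λ e → - (ℤ.+ 2 * e)) (cong₂ _*_ (sym (ε-crossing D cross))
             (cong₂ _-_ (cong₂ _*_ (sym (ε-via-P∪Q s)) (trans (cong -_ (sym (ε-via-Q∪R r))) (sym (ε-anti D b (ι r)))))
                        (cong₂ _*_ (sym (ε-via-Q∪R s)) (trans (cong -_ (sym (ε-via-P∪Q r))) (sym (ε-anti D a (ι r))))))) ⟩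
      - (ℤ.+ 2 * (ε D a b * (ε D a (ι s) * ε D (ι r) b - ε D b (ι s) * ε D (ι r) a))) ∎
      where
      open ≡-Reasoning
      s₁ = arc (x (ι r))
      s₂ = arc (y (ι r))
      s₃ = arc (x (ι s))
      s₄ = arc (y (ι s))
      expand : ∀ σ τ′ A B C D → ℤ.+ 2 * ((σ * σ) * (τ′ * τ′) * (A * B - C * D))
                              ≡ - (ℤ.+ 2 * ((σ * τ′) * ((σ * A) * - (τ′ * B) - (τ′ * C) * - (σ * D))))
      expand = solve-∀
      corrections : ∀ p₁ q₁ r₁ p₂ q₂ r₂ p₃ q₃ r₃ p₄ q₄ r₄ →
        (ℤ.-[1+ 1 ] * (p₁ * q₃ - q₁ * p₃ + p₁ * r₃ - r₁ * p₃ + q₁ * r₃ - r₁ * q₃) - ℤ.-[1+ 1 ] * (p₂ * q₃ - q₂ * p₃ + p₂ * r₃ - r₂ * p₃ + q₂ * r₃ - r₂ * q₃))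
        - (ℤ.-[1+ 1 ] * (p₁ * q₄ - q₁ * p₄ + p₁ * r₄ - r₁ * p₄ + q₁ * r₄ - r₁ * q₄) - ℤ.-[1+ 1 ] * (p₂ * q₄ - q₂ * p₄ + p₂ * r₄ - r₂ * p₄ + q₂ * r₄ - r₂ * q₄))
        ≡ ℤ.+ 2 * ((1ℤ * 1ℤ) * (((p₃ + q₃) - (p₄ + q₄)) * ((q₁ + r₁) - (q₂ + r₂)) - ((q₃ + r₃) - (q₄ + r₄)) * ((p₁ + q₁) - (p₂ + q₂))))
      corrections = solve-∀

    ε-mutate-off : ∀ {r s} → r ≢ s → ε mutate r s ≡ pivoted r s
    ε-mutate-off {r} {s} r≢s = ℤP.*-cancelˡ-≡ (ℤ.+ 2) (ε mutate r s) (pivoted r s) (begin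
      ℤ.+ 2 * ε mutate r s                                   ≡⟨ twice-ε-mutate r≢s ⟩
      ℤ.+ 2 * ε D (ι r) (ι s) + arcCorrection r s            ≡⟨ cong (ℤ.+ 2 * ε D (ι r) (ι s) +_) (arcCorrection≡ r s) ⟩
      ℤ.+ 2 * ε D (ι r) (ι s) + - (ℤ.+ 2 * X)                ≡⟨ distrib (ε D (ι r) (ι s)) X ⟨
      ℤ.+ 2 * pivoted r s                                    ∎)
      where
      open ≡-Reasoning
      X = ε D a b * (ε D a (ι s) * ε D (ι r) b - ε D b (ι s) * ε D (ι r) a)
      distrib : ∀ e X → ℤ.+ 2 * (e - X) ≡ ℤ.+ 2 * e + - (ℤ.+ 2 * X)
      distrib = solve-∀

    ε-mutate : ∀ r s → ε mutate r s ≡ pivoted r s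
    ε-mutate r s = decide (r Fin.≟ s)
      where
      decide : Dec (r ≡ s) → ε mutate r s ≡ pivoted r s
      decide (yes r≡s) = subst (λ t → ε mutate r t ≡ pivoted r t) r≡s (ε-mutate-diag r)
      decide (no r≢s)  = ε-mutate-off r≢s

upperBound : ∀ {n} → (Fin n → ℕ) → ℕ
upperBound {zero}  f = 0
upperBound {suc n} f = f zero ⊔ upperBound (f ∘ suc)

≤-upperBound : ∀ {n} (f : Fin n → ℕ) i → f i ℕ.≤ upperBound f
≤-upperBound f zero    = ℕP.m≤m⊔n (f zero) _
≤-upperBound f (suc i) = ℕP.≤-trans (≤-upperBound (f ∘ suc) i) (ℕP.m≤n⊔m (f zero) _)

det-ε-pivot : ∀ m (D : Chords (suc (suc m))) (j : Fin (suc m)) → ε D zero (suc j) ≢ 0ℤ →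
  Σ (Chords m) λ D′ → det (suc (suc m)) (ε D) ≡ det m (ε D′)
det-ε-pivot m D j ε₀ⱼ≢0 = proj₁ mutated ,
  trans (det-pivot m (ε D) j (ε-diag D zero) (ε-diag D ĵ) (ε²≡1 D (λ ()) ε₀ⱼ≢0) (ε-anti D zero ĵ))
        (det-cong m λ r s → sym (proj₂ mutated r s))
  where
  open Chords D
  ĵ = suc j
  ι : Fin m → Fin (suc (suc m))
  ι = suc ∘ punchIn j
  away : ∀ r → ι r ≢ zero × ι r ≢ ĵ
  away r = (λ ()) , FinP.punchInᵢ≢i j r ∘ FinP.suc-injective
  away′ : ∀ r → ι r ≢ ĵ × ι r ≢ zero
  away′ r = proj₂ (away r) , proj₁ (away r)
  ι-injective : ∀ {r s} → ι r ≡ ι s → r ≡ s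
  ι-injective = FinP.punchIn-injective j _ _ ∘ FinP.suc-injective
  K = suc (upperBound (λ i → x i ⊔ y i))
  x<K : ∀ i → x i < K
  x<K i = ℕ.s≤s (ℕP.≤-trans (ℕP.m≤m⊔n (x i) (y i)) (≤-upperBound (λ i → x i ⊔ y i) i))
  y<K : ∀ i → y i < K
  y<K i = ℕ.s≤s (ℕP.≤-trans (ℕP.m≤n⊔m (x i) (y i)) (≤-upperBound (λ i → x i ⊔ y i) i))
  reorder : ∀ r s → ε D (ι r) (ι s) - ε D ĵ zero * (ε D ĵ (ι s) * ε D (ι r) zero - ε D zero (ι s) * ε D (ι r) ĵ)
                  ≡ pivot (ε D) j r s
  reorder r s = trans
    (cong (λ e → ε D (ι r) (ι s) - e * (ε D ĵ (ι s) * ε D (ι r) zero - ε D zero (ι s) * ε D (ι r) ĵ)) (ε-anti D zero ĵ))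
    (regroup (ε D (ι r) (ι s)) (ε D zero ĵ) (ε D ĵ (ι s)) (ε D (ι r) zero) (ε D zero (ι s)) (ε D (ι r) ĵ))
    where regroup : ∀ e a b c d f → e - - a * (b * c - d * f) ≡ e - a * (d * f - b * c)
          regroup = solve-∀
  mutate-along : Crossing (lo D zero) (hi D zero) (lo D ĵ) (hi D ĵ) ⊎ Crossing (lo D ĵ) (hi D ĵ) (lo D zero) (hi D zero) →
                 Σ (Chords m) λ D′ → ∀ r s → ε D′ r s ≡ pivot (ε D) j r s
  mutate-along (inj₁ cross) = Pivoting.mutate D (λ ()) cross K x<K y<K ι away ι-injective ,
                              Pivoting.ε-mutate D (λ ()) cross K x<K y<K ι away ι-injective
  mutate-along (inj₂ cross) = Pivoting.mutate D (λ ()) cross K x<K y<K ι away′ ι-injective ,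
                              λ r s → trans (Pivoting.ε-mutate D (λ ()) cross K x<K y<K ι away′ ι-injective r s) (reorder r s)
  mutated : Σ (Chords m) λ D′ → ∀ r s → ε D′ r s ≡ pivot (ε D) j r s
  mutated = mutate-along (crossing D (λ ()) ε₀ⱼ≢0)

det-ε∈01 : ∀ n (D : Chords n) → det n (ε D) ≡ 0ℤ ⊎ det n (ε D) ≡ 1ℤ
det-ε∈01 zero          D = inj₂ refl
det-ε∈01 (suc zero)    D = inj₁ (det-zeroRow 1 zero (ε D) λ { zero → ε-diag D zero })
det-ε∈01 (suc (suc m)) D = by-row₀ (FinP.all? (λ j → ε D zero j ℤ.≟ 0ℤ))
  where
  Goal : Set
  Goal = det (suc (suc m)) (ε D) ≡ 0ℤ ⊎ det (suc (suc m)) (ε D) ≡ 1ℤ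
  by-pivot : Σ (Fin (suc (suc m))) (λ j → ε D zero j ≢ 0ℤ) → Goal
  by-pivot (zero  , ε₀₀≢0) = ⊥-elim (ε₀₀≢0 (ε-diag D zero))
  by-pivot (suc j , ε₀ⱼ≢0) = subst (λ d → d ≡ 0ℤ ⊎ d ≡ 1ℤ) (sym (proj₂ smaller)) (det-ε∈01 m (proj₁ smaller))
    where
    smaller : Σ (Chords m) λ D′ → det (suc (suc m)) (ε D) ≡ det m (ε D′)
    smaller = det-ε-pivot m D j ε₀ⱼ≢0
  by-row₀ : Dec (∀ j → ε D zero j ≡ 0ℤ) → Goal
  by-row₀ (yes row₀≡0) = inj₁ (det-zeroRow (suc (suc m)) zero (ε D) row₀≡0)
  by-row₀ (no row₀≢0)  = by-pivot (FinP.¬∀⟶∃¬ _ _ (λ j → ε D zero j ℤ.≟ 0ℤ) row₀≢0)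

-- Chord diagrams cut at a point

restrict : ∀ {n k} (D : Chords n) (e : Fin k → Fin n) → (∀ {a b} → e a ≡ e b → a ≡ b) → Chords k
restrict D e e-injective = record
  { x     = Chords.x D ∘ e
  ; y     = Chords.y D ∘ e
  ; x≢y   = Chords.x≢y D ∘ e
  ; apart = λ a b a≢b → Chords.apart D (e a) (e b) (a≢b ∘ e-injective)
  }

private
  <ᵇ-true : ∀ {m n} → m < n → (m <ᵇ n) ≡ true
  <ᵇ-true {m} {n} m<n with m <ᵇ n | ℕP.<⇒<ᵇ m<n
  ... | true | _ = refl

  <ᵇ-false : ∀ {m n} → ¬ m < n → (m <ᵇ n) ≡ false
  <ᵇ-false {m} {n} m≮n with m <ᵇ n | ℕP.<ᵇ⇒< m n
  ... | true  | m<n = ⊥-elim (m≮n (m<n tt))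
  ... | false | _   = refl

module _ {n} (C : LinChordDiagram n) where

  chords : Chords n
  chords = record { x = left C ; y = right C ; x≢y = ℕP.<⇒≢ ∘ left<right C ; apart = distinct C }

  ε-chords : ∀ i k → ε chords i k ≡ inside (left C i) (right C i) (left C k) - inside (left C i) (right C i) (right C k)
  ε-chords i k = by-orientation (orient chords i)
    where
    I : ℕ → ℕ → ℤ
    I l h = inside l h (left C k) - inside l h (right C k)
    by-orientation : Oriented (left C i) (right C i) (lo chords i) (hi chords i) (τ chords i) →
                     ε chords i k ≡ I (left C i) (right C i)
    by-orientation (forward l≡lo r≡hi τ≡1) =
      trans (cong₂ (λ t d → t * d) τ≡1 (cong₂ I (sym l≡lo) (sym r≡hi))) (ℤP.*-identityˡ (I (left C i) (right C i)))
    by-orientation (backward l≡hi r≡lo _) =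
      ⊥-elim (ℕP.<-asym (left<right C i) (subst₂ _<_ (sym r≡lo) (sym l≡hi) (lo<hi chords i)))

  crosses-< : ∀ {i k} → left C i < left C k → crosses C i k ≡ (left C k <ᵇ right C i) ∧ (right C i <ᵇ right C k)
  crosses-< {i} {k} lᵢ<lₖ rewrite <ᵇ-true lᵢ<lₖ | <ᵇ-false (ℕP.<-asym lᵢ<lₖ) = ∨-identityʳ _

  ε-chords-< : ∀ {i k} → i ≢ k → left C i < left C k → ε chords i k ≡ bit (crosses C i k)
  ε-chords-< {i} {k} i≢k lᵢ<lₖ = trans (ε-chords i k)
    (trans (by-position (left C k <? right C i) (right C i <? right C k)) (cong bit (sym (crosses-< lᵢ<lₖ))))
    where
    rᵢ≢rₖ : right C i ≢ right C k
    rᵢ≢rₖ = proj₂ (proj₂ (distinct C i k i≢k))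
    lₖ≢rᵢ : left C k ≢ right C i
    lₖ≢rᵢ = proj₁ (proj₂ (distinct C k i (i≢k ∘ sym)))
    by-position : Dec (left C k < right C i) → Dec (right C i < right C k) →
      inside (left C i) (right C i) (left C k) - inside (left C i) (right C i) (right C k)
        ≡ bit ((left C k <ᵇ right C i) ∧ (right C i <ᵇ right C k))
    by-position (yes lₖ<rᵢ) (yes rᵢ<rₖ) = trans (cong₂ _-_ (inside-in lᵢ<lₖ lₖ<rᵢ) (inside-≥ (ℕP.<⇒≤ rᵢ<rₖ)))
                                                 (cong bit (sym (cong₂ _∧_ (<ᵇ-true lₖ<rᵢ) (<ᵇ-true rᵢ<rₖ))))
    by-position (yes lₖ<rᵢ) (no rᵢ≮rₖ)  = trans (cong₂ _-_ (inside-in lᵢ<lₖ lₖ<rᵢ)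
                                                    (inside-in (ℕP.<-trans lᵢ<lₖ (left<right C k)) (≮∧≢⇒> rᵢ≮rₖ rᵢ≢rₖ)))
                                                 (cong bit (sym (cong₂ _∧_ (<ᵇ-true lₖ<rᵢ) (<ᵇ-false rᵢ≮rₖ))))
    by-position (no lₖ≮rᵢ)  _            = trans (cong₂ _-_ (inside-≥ (ℕP.<⇒≤ (≮∧≢⇒> lₖ≮rᵢ lₖ≢rᵢ)))
                                                    (inside-≥ (ℕP.<⇒≤ (ℕP.<-trans (≮∧≢⇒> lₖ≮rᵢ lₖ≢rᵢ) (left<right C k)))))
                                                 (cong bit (sym (cong (_∧ (right C i <ᵇ right C k)) (<ᵇ-false lₖ≮rᵢ))))

  orientedAdj-if : ∀ i j → orientedAdj C i j ≡ (if crosses C i j then (if ⌊ i Fin.<? j ⌋ then 1ℤ else -1ℤ) else 0ℤ)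
  orientedAdj-if i j with crosses C i j | ⌊ i Fin.<? j ⌋
  ... | false | _     = refl
  ... | true  | true  = refl
  ... | true  | false = refl

  orientedAdj-ordered : ∀ {i j} (b : Bool) → ⌊ i Fin.<? j ⌋ ≡ b →
    orientedAdj C i j ≡ (if crosses C i j then (if b then 1ℤ else -1ℤ) else 0ℤ)
  orientedAdj-ordered {i} {j} b i<?j≡b =
    trans (orientedAdj-if i j) (cong (λ b → if crosses C i j then (if b then 1ℤ else -1ℤ) else 0ℤ) i<?j≡b)

  orientedAdj≡ε : NumberedByFirstEndpoint C → ∀ i j → orientedAdj C i j ≡ ε chords i j
  orientedAdj≡ε numbered i j = by-order (FinP.<-cmp i j)
    where
    open ≡-Reasoning
    by-order : Tri (i Fin.< j) (i ≡ j) (j Fin.< i) → orientedAdj C i j ≡ ε chords i j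
    by-order (tri< i<j _ _) = begin
      orientedAdj C i j     ≡⟨ orientedAdj-ordered true (trans (isYes≗does (i Fin.<? j)) (dec-true (i Fin.<? j) i<j)) ⟩
      bit (crosses C i j)   ≡⟨ ε-chords-< (FinP.<⇒≢ i<j) (numbered i j i<j) ⟨
      ε chords i j          ∎
    by-order (tri≈ _ refl _) = begin
      orientedAdj C i i     ≡⟨ orientedAdj-ordered false (trans (isYes≗does (i Fin.<? i)) (dec-false (i Fin.<? i) (FinP.<-irrefl refl))) ⟩
      (if crosses C i i then -1ℤ else 0ℤ)
                            ≡⟨ cong (λ c → if c then -1ℤ else 0ℤ) (irrefl (intersectionGraph C) i) ⟩
      0ℤ                    ≡⟨ ε-diag chords i ⟨
      ε chords i i          ∎
    by-order (tri> _ _ j<i) = begin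
      orientedAdj C i j     ≡⟨ orientedAdj-ordered false (trans (isYes≗does (i Fin.<? j)) (dec-false (i Fin.<? j) (FinP.<-asym j<i))) ⟩
      (if crosses C i j then -1ℤ else 0ℤ)
                            ≡⟨ negated (crosses C i j) ⟩
      - bit (crosses C i j) ≡⟨ cong (-_ ∘ bit) (symm (intersectionGraph C) i j) ⟩
      - bit (crosses C j i) ≡⟨ cong -_ (ε-chords-< (FinP.<⇒≢ j<i) (numbered j i j<i)) ⟨
      - ε chords j i        ≡⟨ ε-anti chords j i ⟨
      ε chords i j          ∎
      where
      negated : ∀ c → (if c then -1ℤ else 0ℤ) ≡ - bit c
      negated true  = refl
      negated false = refl

  parity-orientedAdj : ∀ i j → parity (orientedAdj C i j) ≡ crosses C i j
  parity-orientedAdj i j = trans (cong parity (orientedAdj-if i j)) (by-cases (crosses C i j) ⌊ i Fin.<? j ⌋)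
    where
    by-cases : ∀ c b → parity (if c then (if b then 1ℤ else -1ℤ) else 0ℤ) ≡ c
    by-cases false _     = refl
    by-cases true  true  = refl
    by-cases true  false = refl

  principalMinor-orientedAdj : NumberedByFirstEndpoint C → ∀ U →
    principalMinor (λ i j → - orientedAdj C i j) (elems U) ≡ ℤ.+ νInduced (intersectionGraph C) U
  principalMinor-orientedAdj numbered U = begin
    det k (λ a b → - orientedAdj C (e a) (e b))
      ≡⟨ det-cong k (λ a b → trans (cong -_ (orientedAdj≡ε numbered (e a) (e b))) (sym (ε-anti chords (e a) (e b)))) ⟩
    det k (transpose (ε sub))
      ≡⟨ det-transpose k (ε sub) ⟩
    det k (ε sub)
      ≡⟨ ∈01⇒parity (det-ε∈01 k sub) ⟩
    ℤ.+ (if parity (det k (ε sub)) then 1 else 0)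
      ≡⟨ cong (λ b → ℤ.+ (if b then 1 else 0)) parity≡ ⟩
    ℤ.+ νInduced (intersectionGraph C) U ∎
    where
    open ≡-Reasoning
    k = size U
    e = lookup (elems U)
    sub = restrict chords e (elems-injective U)
    ∈01⇒parity : ∀ {d} → d ≡ 0ℤ ⊎ d ≡ 1ℤ → d ≡ ℤ.+ (if parity d then 1 else 0)
    ∈01⇒parity (inj₁ refl) = refl
    ∈01⇒parity (inj₂ refl) = refl
    parity≡ : parity (det k (ε sub)) ≡ det𝔽₂ k (inducedAdj (intersectionGraph C) U)
    parity≡ = trans (parity-det k (ε sub)) (det𝔽₂-cong k λ a b →
      trans (cong parity (sym (orientedAdj≡ε numbered (e a) (e b)))) (parity-orientedAdj (e a) (e b)))

QChord≡QGraph : ∀ {n} (C : LinChordDiagram n) → NumberedByFirstEndpoint C → ∀ u → QChord C u ≡ QGraph (intersectionGraph C) u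
QChord≡QGraph {n} C numbered u = begin
  QChord C u
    ≡⟨ detℤ≡det n _ ⟩
  det n (λ i j → scalarMatrix n u i j + - orientedAdj C i j)
    ≡⟨ det-scalar+-expand n u (λ i j → - orientedAdj C i j) ⟩
  sumList (λ U → u ^ (n ∸ size U) * principalMinor (λ i j → - orientedAdj C i j) (elems U)) (subsets n)
    ≡⟨ sumList-cong (subsets n) (λ U → cong (u ^ (n ∸ size U) *_) (principalMinor-orientedAdj C numbered U)) ⟩
  sumList (λ U → u ^ (n ∸ size U) * ℤ.+ νInduced (intersectionGraph C) U) (subsets n)
    ≡⟨ QGraph-subsetSum (intersectionGraph C) u ⟨
  QGraph (intersectionGraph C) u ∎
  where open ≡-Reasoning

mainTheorem4 :
    (∀ {n} (C : LinChordDiagram n) → NumberedByFirstEndpoint C →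
       ∀ (u : ℤ) → QChord C u ≡ QGraph (intersectionGraph C) u)
    × (∀ {n m} (C₁ : LinChordDiagram n) (C₂ : LinChordDiagram m) →
       NumberedByFirstEndpoint C₁ → NumberedByFirstEndpoint C₂ →
       GraphIso (intersectionGraph C₁) (intersectionGraph C₂) →
       ∀ (u : ℤ) → QChord C₁ u ≡ QChord C₂ u)
mainTheorem4 = QChord≡QGraph , λ C₁ C₂ numbered₁ numbered₂ iso u → begin
  QChord C₁ u                       ≡⟨ QChord≡QGraph C₁ numbered₁ u ⟩
  QGraph (intersectionGraph C₁) u   ≡⟨ QGraph-iso (intersectionGraph C₁) (intersectionGraph C₂) iso u ⟩
  QGraph (intersectionGraph C₂) u   ≡⟨ QChord≡QGraph C₂ numbered₂ u ⟨
  QChord C₂ u                       ∎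
  where open ≡-Reasoning
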